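{- Let $u\in\mathcal W_n$ be a word of type $\mathbf m$, let $k=p_\alpha(\mathbf m)$ for some $\alpha\ge 0$, and let $q$ be a queue with $k\le|q|$. Then each site $j\in[q(u)]_k$ contributes a matched closing parenthesis to $\mathrm{SP}([u]_k,q)$.
   Context: Sites $1,\dots,n$ are arranged cyclically. $\mathcal{W}_n$ is the set of words $u=u_1\cdots u_n$ with letters in $\{1,2,\dots\}$; the type of $u$ is $\mathbf m=(m_1,m_2,\dots)$, $m_i$ the number of letters equal to $i$; $p_i(\mathbf m)=m_1+\cdots+m_i$, $p_0=0$. For a word $w$ of type $\mathbf n$ and $k\in\{p_i(\mathbf n):i\ge0\}$, $[w]_k$ is the set of sites carrying the $k$ smallest letters of $w$. A queue is a subset $q\subseteq\{1,\dots,n\}$. For a queue $q$ and $u$, $v=q(u)$: choose a permutation $(i_1,\dots,i_n)$ of $(1,\dots,n)$ with $u_{i_1}\le\cdots\le u_{i_n}$; Phase I: for $i=i_n,\dots,i_{|q|+1}$ in order, take the first site $j$ weakly to the left of $i$ (cyclically) with $j\notin q$ and $v_j$ unset, set $v_j=u_i+1$; Phase II: for $i=i_1,\dots,i_{|q|}$ in order, take the first site $j$ weakly to the right of $i$ (cyclically) with $j\in q$ and $v_j$ unset, set $v_j=u_i$. For queues $(q_1,q_2)$, form a cyclic sequence of parentheses by going through $j=1,\dots,n$ and writing "(" if $j\in q_1\setminus q_2$, ")" if $j\in q_2\setminus q_1$, "()" if $j\in q_1\cap q_2$, nothing otherwise (contributed by $j$); then repeatedly match an opening parenthesis with a closing parenthesis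 after it (cyclically) whenever all parentheses strictly between them are already matched, until no further match is possible. $\mathrm{SP}(q_1,q_2)$ is this sequence together with the resulting matching and the correspondence between sites and the closing parentheses they contribute. -}

module Defs where

open import Data.Nat using (ℕ; zero; suc; _+_; _≤_; _<_; _≤ᵇ_)
open import Data.Bool using (Bool; true; false; not; _∧_; if_then_else_)
open import Data.Fin using (Fin; toℕ; _≟_)
open import Data.Fin.Subset using (Subset; ∣_∣)
open import Data.Vec using (tabulate; lookup)
open import Data.List using (List; []; _∷_; _++_; reverse; take; drop; foldl; concatMap; allFin; length)
open import Data.List.Relation.Unary.Any using (Any)
open import Data.List.Relation.Unary.Linked using (Linked)
open import Data.List.Relation.Binary.Permutation.Propositional using (_↭_)
open import Data.Maybe using (Maybe; just; nothing; is-nothing; fromMaybe)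
open import Data.Product using (_×_; _,_; ∃)
open import Data.Sum using (_⊎_)
open import Relation.Nullary using (¬_; does)
open import Relation.Binary.PropositionalEquality using (_≡_)
open import Relation.Binary.Construct.Closure.ReflexiveTransitive using (Star)

-- A word u = u_1 ⋯ u_n : the letter at site j.  Sites 1..n are Fin n
-- (site 1 is index 0).  Letters are positive naturals; positivity is a
-- hypothesis (IsWord) in the statement.
Word : ℕ → Set
Word n = Fin n → ℕ

IsWord : ∀ {n} → Word n → Set
IsWord u = ∀ j → 1 ≤ u j

count : ∀ {n} → (Fin n → Bool) → ℕ
count P = ∣ tabulate P ∣

typeOf : ∀ {n} → Word n → ℕ → ℕ
typeOf u i = count (λ j → does (u j Data.Nat.≟ i))

p : (ℕ → ℕ) → ℕ → ℕ
p m zero    = 0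
p m (suc i) = p m i + m (suc i)

-- [w]_k : the set of sites carrying the k smallest letters of w
-- (for k a partial sum of the type of w): site j belongs to it iff the
-- number of sites whose letter is ≤ w_j is at most k.
lowest : ∀ {n} → Word n → ℕ → Subset n
lowest w k = tabulate (λ j → count (λ i → w i ≤ᵇ w j) ≤ᵇ k)

Queue : ℕ → Set
Queue n = Subset n

first : ∀ {A : Set} → (A → Bool) → List A → Maybe A
first P []       = nothing
first P (x ∷ xs) = if P x then just x else first P xs

-- sites i, i+1, …, n, 1, …, i-1  (cyclically, weakly to the right of i)
rightOrder : ∀ {n} → Fin n → List (Fin n)
rightOrder {n} i = drop (toℕ i) (allFin n) ++ take (toℕ i) (allFin n)

-- sites i, i-1, …, 1, n, …, i+1  (cyclically, weakly to the left of i)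
leftOrder : ∀ {n} → Fin n → List (Fin n)
leftOrder {n} i = reverse (take (suc (toℕ i)) (allFin n))
               ++ reverse (drop (suc (toℕ i)) (allFin n))

Partial : ℕ → Set
Partial n = Fin n → Maybe ℕ

setAt : ∀ {n} → Partial n → Fin n → ℕ → Partial n
setAt v j x j' = if does (j' ≟ j) then just x else v j'

phaseIStep : ∀ {n} → Queue n → Word n → Partial n → Fin n → Partial n
phaseIStep q u v i with first (λ j → not (lookup q j) ∧ is-nothing (v j)) (leftOrder i)
... | nothing = v
... | just j  = setAt v j (suc (u i))

phaseIIStep : ∀ {n} → Queue n → Word n → Partial n → Fin n → Partial n
phaseIIStep q u v i with first (λ j → lookup q j ∧ is-nothing (v j)) (rightOrder i)
... | nothing = v
... | just j  = setAt v j (u i)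

SortingPerm : ∀ {n} → Word n → List (Fin n) → Set
SortingPerm {n} u σ = (σ ↭ allFin n) × Linked (λ a b → u a ≤ u b) σ

-- v = q(u) computed with respect to the chosen sorting permutation σ.
-- Phase I runs over i_n, …, i_{|q|+1}; Phase II over i_1, …, i_{|q|}.
-- (Every site gets set by the procedure; the default 0 is never used.)
applyQueue : ∀ {n} → Queue n → Word n → List (Fin n) → Word n
applyQueue q u σ j = fromMaybe 0 (v j)
  where
  vI : Partial _
  vI = foldl (phaseIStep q u) (λ _ → nothing) (reverse (drop ∣ q ∣ σ))
  v : Partial _
  v = foldl (phaseIIStep q u) vI (take ∣ q ∣ σ)

-- a parenthesis, tagged with the site contributing it; true = "(",
-- false = ")"
Paren : ℕ → Set
Paren n = Fin n × Bool

contrib : ∀ {n} → Queue n → Queue n → Fin n → List (Paren n)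
contrib q₁ q₂ j with lookup q₁ j | lookup q₂ j
... | true  | false = (j , true) ∷ []
... | false | true  = (j , false) ∷ []
... | true  | true  = (j , true) ∷ (j , false) ∷ []
... | false | false = []

-- the cyclic sequence of parentheses (positions 0 … length-1)
parens : ∀ {n} → Queue n → Queue n → List (Paren n)
parens {n} q₁ q₂ = concatMap (contrib q₁ q₂) (allFin n)

_!?_ : ∀ {A : Set} → List A → ℕ → Maybe A
[]       !? _     = nothing
(x ∷ xs) !? zero  = just x
(x ∷ xs) !? suc k = xs !? k

OpenAt : ∀ {n} → List (Paren n) → ℕ → Set
OpenAt s a = ∃ λ j → s !? a ≡ just (j , true)

CloseAt : ∀ {n} → List (Paren n) → ℕ → Set
CloseAt s b = ∃ λ j → s !? b ≡ just (j , false)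

-- a (partial) matching: list of matched pairs (opening pos , closing pos)
Matching : Set
Matching = List (ℕ × ℕ)

Matched : Matching → ℕ → Set
Matched M x = Any (λ ab → Data.Product.proj₁ ab ≡ x ⊎ Data.Product.proj₂ ab ≡ x) M

-- position x lies strictly between a and b, going cyclically forward
-- from a to b, in a cyclic sequence of length L
CycBetween : ℕ → ℕ → ℕ → ℕ → Set
CycBetween L a b x = (a < b × a < x × x < b) ⊎ (b < a × ((a < x × x < L) ⊎ x < b))

data Step {n} (s : List (Paren n)) : Matching → Matching → Set where
  step : ∀ {M} a b → OpenAt s a → CloseAt s b → ¬ Matched M a → ¬ Matched M b
       → (∀ x → CycBetween (length s) a b x → Matched M x)
       → Step s M ((a , b) ∷ M)

FinalMatching : ∀ {n} → List (Paren n) → Matching → Set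
FinalMatching s M = Star (Step s) [] M × (∀ M' → ¬ Step s M M')

-- Let A = [u]_k be the sites of the k letters ≤ α.  Phase I writes letters > α + 1 outside q,
-- and the first k steps of Phase II process exactly the sites of A, writing their letters
-- ≤ α into k sites of q; every other site receives a letter > α.  So [q(u)]_k is the set of
-- sites filled while processing A, and each of them must be shown to have a matched ")".
--
-- In a final matching of SP(A, q), where #"(" = |A| ≤ |q| = #")", every "(" is matched, and
-- if the ")" of a site f stays unmatched then every arc (y, f] with y ∈ q carries more ")"
-- than "(": a pair matched while f is unmatched never straddles f.  Now let b ∈ A fill f,
-- and let y be the unset site of q nearest before f.  All sites of q in (y, f] other than f
-- are already filled, and the greedy filling keeps the invariant that on an arc starting
-- just after an unset site of q there are no more filled sites of q than processed sites
-- of A.  Counting f and b as well, (y, f] has no more sites of q than of A, a contradiction.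

module Submission where

open import Defs

open import Data.Nat using (ℕ; zero; suc; _+_; _∸_; _≤_; _<_; _≤ᵇ_; _≡ᵇ_; z≤n; s≤s; _≤?_; _<?_)
open import Data.Nat.Properties
open import Data.Nat.ListAction using (sum)
open import Data.Nat.ListAction.Properties using (sum-↭)
open import Algebra.Properties.CommutativeSemigroup +-commutativeSemigroup using (x∙yz≈y∙xz; interchange)
open import Data.Bool using (Bool; true; false; not; _∧_; _∨_)
open import Data.Bool.Properties using (∧-conicalˡ; ∧-conicalʳ; ∧-zeroˡ; ∧-zeroʳ; ∧-identityʳ; ∨-zeroʳ; ∨-identityʳ)
open import Data.Fin using (Fin; toℕ; zero; suc)
import Data.Fin as Fin
import Data.Fin.Properties as Fin
open import Data.Fin.Subset using (Subset; ∣_∣)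
open import Data.Fin.Subset.Properties using (∣p∣≤n)
open import Data.Vec using (lookup)
import Data.Vec as Vec
open import Data.Vec.Properties using (lookup∘tabulate)
open import Data.List using (List; []; _∷_; _++_; length; take; drop; reverse; foldl; allFin; concatMap)
import Data.List as List
open import Data.List.Properties
  using (length-++; length-take; length-drop; length-reverse; length-tabulate; take++drop≡id; drop-drop; foldl-++)
open import Data.List.Membership.Propositional using (_∈_)
open import Data.List.Membership.Propositional.Properties using (∈-allFin; ∈-++⁺ˡ; ∈-++⁺ʳ; ∈-++⁻)
open import Data.List.Relation.Unary.Any using (Any; here; there; any?)
import Data.List.Relation.Unary.Any.Properties as AnyP
open import Data.List.Relation.Unary.All as All using (All; []; _∷_)
import Data.List.Relation.Unary.All.Properties as AllP
open import Data.List.Relation.Unary.AllPairs using (AllPairs; []; _∷_)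
import Data.List.Relation.Unary.AllPairs.Properties as APP
open import Data.List.Relation.Unary.Linked as Linked using (Linked; []; _∷_)
open import Data.List.Relation.Unary.Unique.Propositional using (Unique)
open import Data.List.Relation.Unary.Unique.Propositional.Properties using (allFin⁺)
open import Data.List.Relation.Binary.Permutation.Propositional using (_↭_; ↭-sym; ↭⇒↭ₛ)
open import Data.List.Relation.Binary.Permutation.Propositional.Properties using (↭-length) renaming (map⁺ to ↭-map⁺)
open import Data.Maybe using (Maybe; just; nothing; is-just; is-nothing; fromMaybe)
open import Data.Maybe.Properties using (just-injective)
open import Data.Product using (∃; _×_; _,_; proj₁; proj₂; map₁; map₂)
open import Data.Sum using (_⊎_; inj₁; inj₂)
open import Data.Empty using (⊥; ⊥-elim)
open import Function using (_∘_; id)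
open import Function.Bundles using (_⇔_; mk⇔; Equivalence)
open import Relation.Nullary using (¬_; Dec; yes; no; does)
open import Relation.Nullary.Decidable using (dec-true; dec-false; _×-dec_; _⊎-dec_)
open import Relation.Binary using (tri<; tri≈; tri>)
open import Relation.Binary.PropositionalEquality hiding (J)
open import Relation.Binary.Construct.Closure.ReflexiveTransitive using (Star; ε; _◅_)

does⇒ : ∀ {P : Set} (P? : Dec P) → does P? ≡ true → P
does⇒ (yes p) _ = p

does-⇔ : ∀ {P Q : Set} (P? : Dec P) (Q? : Dec Q) → P ⇔ Q → does P? ≡ does Q?
does-⇔ (yes p) Q? P⇔Q = sym (dec-true Q? (Equivalence.to P⇔Q p))
does-⇔ (no ¬p) Q? P⇔Q = sym (dec-false Q? (¬p ∘ Equivalence.from P⇔Q))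

true≢false : ¬ true ≡ false
true≢false ()

just≢nothing : ∀ {A : Set} {x : A} → just x ≢ nothing
just≢nothing ()

ind : Bool → ℕ
ind true  = 1
ind false = 0

ind-mono : ∀ {a b} → (a ≡ true → b ≡ true) → ind a ≤ ind b
ind-mono {true}  h rewrite h refl = ≤-refl
ind-mono {false} h = z≤n

private
  variable
    n : ℕ

-- Counting

∑ : ∀ {n} → (Fin n → ℕ) → ℕ
∑ {zero}  f = 0
∑ {suc n} f = f zero + ∑ (f ∘ suc)

∑-mono : {f g : Fin n → ℕ} → (∀ x → f x ≤ g x) → ∑ f ≤ ∑ g
∑-mono {zero}  h = z≤n
∑-mono {suc n} h = +-mono-≤ (h zero) (∑-mono (h ∘ suc))

∑-cong : {f g : Fin n → ℕ} → (∀ x → f x ≡ g x) → ∑ f ≡ ∑ g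
∑-cong {zero}  h = refl
∑-cong {suc n} h = cong₂ _+_ (h zero) (∑-cong (h ∘ suc))

∑-+ : (f g : Fin n → ℕ) → ∑ (λ x → f x + g x) ≡ ∑ f + ∑ g
∑-+ {zero}  f g = refl
∑-+ {suc n} f g = trans (cong (f zero + g zero +_) (∑-+ (f ∘ suc) (g ∘ suc))) (interchange (f zero) (g zero) _ _)

∑-zero : (f : Fin n → ℕ) → (∀ x → f x ≡ 0) → ∑ f ≡ 0
∑-zero {zero}  f h = refl
∑-zero {suc n} f h rewrite h zero = ∑-zero (f ∘ suc) (h ∘ suc)

∑-single : (f : Fin n → ℕ) (a : Fin n) → (∀ x → x ≢ a → f x ≡ 0) → ∑ f ≡ f a
∑-single {suc n} f zero h =
  trans (cong (f zero +_) (∑-zero _ (λ x → h (suc x) λ ()))) (+-identityʳ _)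
∑-single {suc n} f (suc a) h rewrite h zero (λ ()) =
  ∑-single (f ∘ suc) a (λ x x≢a → h (suc x) (x≢a ∘ Fin.suc-injective))

∑-strict : (f g : Fin n → ℕ) (a : Fin n) → (∀ x → f x ≤ g x) → f a < g a → ∑ f < ∑ g
∑-strict {suc n} f g zero    h lt = +-mono-<-≤ lt (∑-mono (h ∘ suc))
∑-strict {suc n} f g (suc a) h lt = +-mono-≤-< (h zero) (∑-strict _ _ a (h ∘ suc) lt)

∑-insert : (f g : Fin n → ℕ) (a : Fin n) → (∀ x → x ≢ a → f x ≡ g x) → g a ≡ suc (f a) → ∑ g ≡ suc (∑ f)
∑-insert {suc n} f g zero h ga
  rewrite ga | ∑-cong {f = f ∘ suc} {g = g ∘ suc} (λ x → h (suc x) λ ()) = refl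
∑-insert {suc n} f g (suc a) h ga
  rewrite h zero (λ ()) | ∑-insert (f ∘ suc) (g ∘ suc) a (λ x x≢a → h (suc x) (x≢a ∘ Fin.suc-injective)) ga
  = +-suc (g zero) _

∑-tight : (f g : Fin n → ℕ) → (∀ x → f x ≤ g x) → ∑ g ≤ ∑ f → ∀ x → g x ≤ f x
∑-tight {suc n} f g h e zero with m≤n⇒m<n∨m≡n (h zero)
... | inj₂ f₀≡g₀ = ≤-reflexive (sym f₀≡g₀)
... | inj₁ f₀<g₀ = ⊥-elim (<⇒≱ (+-mono-<-≤ f₀<g₀ (∑-mono (h ∘ suc))) e)
∑-tight {suc n} f g h e (suc x) = ∑-tight (f ∘ suc) (g ∘ suc) (h ∘ suc) tail≤ x
  where
  tail≤ : ∑ (g ∘ suc) ≤ ∑ (f ∘ suc)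
  tail≤ = +-cancelˡ-≤ (g zero) _ _ (≤-trans e (+-monoˡ-≤ _ (h zero)))

_⊆_ : {A : Set} → (A → Bool) → (A → Bool) → Set
P ⊆ R = ∀ x → P x ≡ true → R x ≡ true

infixr 6 _∩_
infixr 5 _∪_

_∩_ _∪_ : {A : Set} → (A → Bool) → (A → Bool) → A → Bool
(P ∩ R) x = P x ∧ R x
(P ∪ R) x = P x ∨ R x

∩-intro : ∀ {A : Set} {P R : A → Bool} {x} → P x ≡ true → R x ≡ true → (P ∩ R) x ≡ true
∩-intro Px Rx rewrite Px | Rx = refl

∩-monoˡ : ∀ {A : Set} {P R : A → Bool} (J : A → Bool) → P ⊆ R → (P ∩ J) ⊆ (R ∩ J)
∩-monoˡ {P = P} {R} J P⊆R x h with P x in Px | J x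
... | true | true rewrite P⊆R x Px = refl

⁅_⁆ : Fin n → Fin n → Bool
⁅ a ⁆ x = does (x Fin.≟ a)

# : (Fin n → Bool) → ℕ
# P = ∑ (ind ∘ P)

#-mono : {P R : Fin n → Bool} → P ⊆ R → # P ≤ # R
#-mono P⊆R = ∑-mono (λ x → ind-mono (P⊆R x))

#-cong : {P R : Fin n → Bool} → (∀ x → P x ≡ R x) → # P ≡ # R
#-cong P≗R = ∑-cong (cong ind ∘ P≗R)

∣∣≡# : (S : Subset n) → ∣ S ∣ ≡ # (lookup S)
∣∣≡# {zero}  Vec.[]           = refl
∣∣≡# {suc n} (true  Vec.∷ S) = cong suc (∣∣≡# S)
∣∣≡# {suc n} (false Vec.∷ S) = ∣∣≡# S

count≡# : (P : Fin n → Bool) → count P ≡ # P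
count≡# P = trans (∣∣≡# (Vec.tabulate P)) (#-cong (lookup∘tabulate P))

#-complement : (P : Fin n → Bool) → # P + # (not ∘ P) ≡ n
#-complement {zero}  P = refl
#-complement {suc n} P with P zero | #-complement (P ∘ suc)
... | true  | ih = cong suc ih
... | false | ih = trans (+-suc _ _) (cong suc ih)

#-∩⁅⁆ : (J : Fin n → Bool) (a : Fin n) → # (⁅ a ⁆ ∩ J) ≡ ind (J a)
#-∩⁅⁆ J a = trans (∑-single _ a outside) (cong (λ t → ind (t ∧ J a)) (dec-true (a Fin.≟ a) refl))
  where
  outside : ∀ x → x ≢ a → ind ((⁅ a ⁆ ∩ J) x) ≡ 0
  outside x x≢a rewrite dec-false (x Fin.≟ a) x≢a = refl

#-∪⁅⁆-≤ : (P J : Fin n → Bool) (a : Fin n) → # ((P ∪ ⁅ a ⁆) ∩ J) ≤ # (P ∩ J) + ind (J a)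
#-∪⁅⁆-≤ P J a = begin
  # ((P ∪ ⁅ a ⁆) ∩ J)                    ≤⟨ ∑-mono (λ x → ind-∨ (P x) (⁅ a ⁆ x) (J x)) ⟩
  ∑ (λ x → ind ((P ∩ J) x) + ind ((⁅ a ⁆ ∩ J) x)) ≡⟨ ∑-+ (ind ∘ (P ∩ J)) (ind ∘ (⁅ a ⁆ ∩ J)) ⟩
  # (P ∩ J) + # (⁅ a ⁆ ∩ J)              ≡⟨ cong (# (P ∩ J) +_) (#-∩⁅⁆ J a) ⟩
  # (P ∩ J) + ind (J a)                  ∎
  where
  open ≤-Reasoning
  ind-∨ : ∀ p e j → ind ((p ∨ e) ∧ j) ≤ ind (p ∧ j) + ind (e ∧ j)
  ind-∨ true  e     true  = s≤s z≤n
  ind-∨ false true  true  = s≤s z≤n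
  ind-∨ false false true  = z≤n
  ind-∨ p     e     false rewrite ∧-zeroʳ (p ∨ e) = z≤n

#-∪⁅⁆ : (P J : Fin n → Bool) (a : Fin n) → P a ≡ false → # ((P ∪ ⁅ a ⁆) ∩ J) ≡ # (P ∩ J) + ind (J a)
#-∪⁅⁆ P J a Pa≡false = begin
  # ((P ∪ ⁅ a ⁆) ∩ J)                    ≡⟨ ∑-cong (λ x → ind-∨ (P x) (⁅ a ⁆ x) (J x) (disjoint x)) ⟩
  ∑ (λ x → ind ((P ∩ J) x) + ind ((⁅ a ⁆ ∩ J) x)) ≡⟨ ∑-+ (ind ∘ (P ∩ J)) (ind ∘ (⁅ a ⁆ ∩ J)) ⟩
  # (P ∩ J) + # (⁅ a ⁆ ∩ J)              ≡⟨ cong (# (P ∩ J) +_) (#-∩⁅⁆ J a) ⟩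
  # (P ∩ J) + ind (J a)                  ∎
  where
  open ≡-Reasoning
  disjoint : ∀ x → P x ≡ true → ⁅ a ⁆ x ≡ false
  disjoint x Px = dec-false (x Fin.≟ a) λ { refl → true≢false (trans (sym Px) Pa≡false) }
  ind-∨ : ∀ p e j → (p ≡ true → e ≡ false) → ind ((p ∨ e) ∧ j) ≡ ind (p ∧ j) + ind (e ∧ j)
  ind-∨ true  e     j h rewrite h refl | ∧-zeroˡ j = sym (+-identityʳ _)
  ind-∨ false e     j h = refl

#-∪⁅⁆-new : (P : Fin n → Bool) (a : Fin n) → P a ≡ false → # (P ∪ ⁅ a ⁆) ≡ suc (# P)
#-∪⁅⁆-new P a Pa = ∑-insert _ _ a elsewhere at-a
  where
  elsewhere : ∀ x → x ≢ a → ind (P x) ≡ ind ((P ∪ ⁅ a ⁆) x)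
  elsewhere x x≢a rewrite dec-false (x Fin.≟ a) x≢a = cong ind (sym (∨-identityʳ (P x)))
  at-a : ind ((P ∪ ⁅ a ⁆) a) ≡ suc (ind (P a))
  at-a rewrite Pa | dec-true (a Fin.≟ a) refl = refl

ArgMax : (Fin n → Bool) → (Fin n → ℕ) → Fin n → Set
ArgMax P r m = P m ≡ true × (∀ x → P x ≡ true → r x ≤ r m)

argmax : (P : Fin n → Bool) (r : Fin n → ℕ) → (∀ x → P x ≡ false) ⊎ ∃ (ArgMax P r)
argmax {zero}  P r = inj₁ (λ ())
argmax {suc n} P r with argmax (P ∘ suc) (r ∘ suc) | P zero in P₀
... | inj₁ none | false = inj₁ λ { zero → P₀ ; (suc x) → none x }
... | inj₁ none | true  = inj₂ (zero , P₀ , λ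
  { zero    _  → ≤-refl
  ; (suc x) Px → ⊥-elim (true≢false (trans (sym Px) (none x))) })
... | inj₂ (m , Pm , max) | false = inj₂ (suc m , Pm , λ
  { zero    Px → ⊥-elim (true≢false (trans (sym Px) P₀))
  ; (suc x) Px → max x Px })
... | inj₂ (m , Pm , max) | true with r zero ≤? r (suc m)
...   | yes r₀≤ = inj₂ (suc m , Pm , λ { zero _ → r₀≤ ; (suc x) Px → max x Px })
...   | no r₀≰  = inj₂ (zero , P₀ , λ { zero _ → ≤-refl ; (suc x) Px → ≤-trans (max x Px) (<⇒≤ (≰⇒> r₀≰)) })

argmax-∃ : (P : Fin n → Bool) (r : Fin n → ℕ) {a : Fin n} → P a ≡ true → ∃ (ArgMax P r)
argmax-∃ P r {a} Pa with argmax P r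
... | inj₁ none = ⊥-elim (true≢false (trans (sym Pa) (none a)))
... | inj₂ max  = max

∑< : ℕ → (ℕ → ℕ) → ℕ
∑< zero    f = 0
∑< (suc L) f = ∑< L f + f L

#< : ℕ → (ℕ → Bool) → ℕ
#< L P = ∑< L (ind ∘ P)

∑<-cong : ∀ L {f g : ℕ → ℕ} → (∀ x → x < L → f x ≡ g x) → ∑< L f ≡ ∑< L g
∑<-cong zero    h = refl
∑<-cong (suc L) h = cong₂ _+_ (∑<-cong L (λ x x<L → h x (m≤n⇒m≤1+n x<L))) (h L ≤-refl)

∑<-zero : ∀ L (f : ℕ → ℕ) → (∀ x → x < L → f x ≡ 0) → ∑< L f ≡ 0
∑<-zero zero    f h = refl
∑<-zero (suc L) f h rewrite h L ≤-refl = trans (+-identityʳ _) (∑<-zero L f (λ x x<L → h x (m≤n⇒m≤1+n x<L)))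

∑<-insert : ∀ L (f g : ℕ → ℕ) a → a < L → (∀ x → x < L → x ≢ a → f x ≡ g x)
  → g a ≡ suc (f a) → ∑< L g ≡ suc (∑< L f)
∑<-insert (suc L) f g a a<1+L h ga with a ≟ L
... | yes refl rewrite ga | ∑<-cong L {f} {g} (λ x x<L → h x (m≤n⇒m≤1+n x<L) (<⇒≢ x<L)) = +-suc _ _
... | no a≢L rewrite h L ≤-refl (a≢L ∘ sym)
                   | ∑<-insert L f g a (≤∧≢⇒< (≤-pred a<1+L) a≢L) (λ x x<L → h x (m≤n⇒m≤1+n x<L)) ga = refl

∑<-+ : ∀ a b (f : ℕ → ℕ) → ∑< (a + b) f ≡ ∑< a f + ∑< b (λ d → f (a + d))
∑<-+ a zero    f = trans (cong (λ z → ∑< z f) (+-identityʳ a)) (sym (+-identityʳ _))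
∑<-+ a (suc b) f = begin
  ∑< (a + suc b) f                                   ≡⟨ cong (λ z → ∑< z f) (+-suc a b) ⟩
  ∑< (a + b) f + f (a + b)                           ≡⟨ cong (_+ f (a + b)) (∑<-+ a b f) ⟩
  (∑< a f + ∑< b (λ d → f (a + d))) + f (a + b)     ≡⟨ +-assoc (∑< a f) _ _ ⟩
  ∑< a f + (∑< b (λ d → f (a + d)) + f (a + b))     ∎
  where open ≡-Reasoning

#<-witness : ∀ L (P : ℕ → Bool) → 0 < #< L P → ∃ λ x → x < L × P x ≡ true
#<-witness (suc L) P pos with P L in PL
... | true  = L , ≤-refl , PL
... | false with #<-witness L P (subst (0 <_) (+-identityʳ _) pos)
...   | x , x<L , Px = x , m≤n⇒m≤1+n x<L , Px

#<-member : ∀ L (P : ℕ → Bool) x → x < L → P x ≡ true → 1 ≤ #< L P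
#<-member (suc L) P x x<1+L Px with x ≟ L
... | yes refl rewrite Px = m≤n+m 1 _
... | no x≢L = ≤-trans (#<-member L P x (≤∧≢⇒< (≤-pred x<1+L) x≢L) Px) (m≤m+n _ _)

module _ (P : ℕ → Bool) where

  least-between : ∀ a c → a ≤ c → P c ≡ true →
    ∃ λ m → a ≤ m × m ≤ c × P m ≡ true × (∀ y → a ≤ y → y < m → P y ≡ false)
  least-between a c a≤c Pc = search (c ∸ a) a ≤-refl (m∸n+n≡m a≤c) (λ y a≤y y<a → ⊥-elim (<⇒≱ y<a a≤y))
    where
    search : ∀ d k → a ≤ k → d + k ≡ c → (∀ y → a ≤ y → y < k → P y ≡ false) →
      ∃ λ m → a ≤ m × m ≤ c × P m ≡ true × (∀ y → a ≤ y → y < m → P y ≡ false)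
    search zero    k a≤k refl below = k , a≤k , ≤-refl , Pc , below
    search (suc d) k a≤k d+k≡c below with P k in Pk
    ... | true  = k , a≤k , subst (k ≤_) d+k≡c (m≤n+m k (suc d)) , Pk , below
    ... | false = search d (suc k) (m≤n⇒m≤1+n a≤k) (trans (+-suc d k) d+k≡c) below′
      where
      below′ : ∀ y → a ≤ y → y < suc k → P y ≡ false
      below′ y a≤y y<1+k with y ≟ k
      ... | yes refl = Pk
      ... | no y≢k   = below y a≤y (≤∧≢⇒< (≤-pred y<1+k) y≢k)

  greatest-below : ∀ a c → P a ≡ true → a < c →
    ∃ λ m → a ≤ m × m < c × P m ≡ true × (∀ y → m < y → y < c → P y ≡ false)
  greatest-below a (suc c) Pa a<1+c with P c in Pc
  ... | true  = c , ≤-pred a<1+c , ≤-refl , Pc , λ y c<y y<1+c → ⊥-elim (<⇒≱ c<y (≤-pred y<1+c))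
  ... | false with a ≟ c
  ...   | yes refl = ⊥-elim (true≢false (trans (sym Pa) Pc))
  ...   | no a≢c with greatest-below a c Pa (≤∧≢⇒< (≤-pred a<1+c) a≢c)
  ...     | m , a≤m , m<c , Pm , above = m , a≤m , m≤n⇒m≤1+n m<c , Pm , above′
    where
    above′ : ∀ y → m < y → y < suc c → P y ≡ false
    above′ y m<y y<1+c with y ≟ c
    ... | yes refl = Pc
    ... | no y≢c   = above y m<y (≤∧≢⇒< (≤-pred y<1+c) y≢c)

-- Cyclic arcs

-- ArcOC y z is the arc (y, z], the whole circle when y ≡ z; ArcCO s f is [s, f), empty when s ≡ f.

ArcOC : ℕ → ℕ → ℕ → Set
ArcOC y z x = (y < z × y < x × x ≤ z) ⊎ (z < y × (y < x ⊎ x ≤ z)) ⊎ y ≡ z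

ArcCO : ℕ → ℕ → ℕ → Set
ArcCO s f x = (s ≤ f × s ≤ x × x < f) ⊎ (f < s × (s ≤ x ⊎ x < f))

arcOC? : ∀ y z x → Dec (ArcOC y z x)
arcOC? y z x = ((y <? z) ×-dec ((y <? x) ×-dec (x ≤? z)))
         ⊎-dec (((z <? y) ×-dec ((y <? x) ⊎-dec (x ≤? z))) ⊎-dec (y ≟ z))

ArcOC-end : ∀ y z → ArcOC y z z
ArcOC-end y z with <-cmp y z
... | tri< y<z _ _ = inj₁ (y<z , y<z , ≤-refl)
... | tri≈ _ y≡z _ = inj₂ (inj₂ y≡z)
... | tri> _ _ z<y = inj₂ (inj₁ (z<y , inj₂ ≤-refl))

ArcOC-retreat : ∀ {s f y z} → ¬ ArcCO s f y → ArcOC y z f → ArcOC y z s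
ArcOC-retreat avoid (inj₂ (inj₂ y≡z)) = inj₂ (inj₂ y≡z)
ArcOC-retreat {s} {f} {y} {z} avoid (inj₁ (y<z , y<f , f≤z)) with s ≤? f
... | no s≰f = ⊥-elim (avoid (inj₂ (≰⇒> s≰f , inj₂ y<f)))
... | yes s≤f with s ≤? y
...   | yes s≤y = ⊥-elim (avoid (inj₁ (s≤f , s≤y , y<f)))
...   | no s≰y  = inj₁ (y<z , ≰⇒> s≰y , ≤-trans s≤f f≤z)
ArcOC-retreat {s} {f} {y} {z} avoid (inj₂ (inj₁ (z<y , inside))) with s ≤? y
... | no s≰y = inj₂ (inj₁ (z<y , inj₁ (≰⇒> s≰y)))
... | yes s≤y with s ≤? f
...   | no s≰f = ⊥-elim (avoid (inj₂ (≰⇒> s≰f , inj₁ s≤y)))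
...   | yes s≤f with inside
...     | inj₁ y<f = ⊥-elim (avoid (inj₁ (s≤f , s≤y , y<f)))
...     | inj₂ f≤z = inj₂ (inj₁ (z<y , inj₂ (≤-trans s≤f f≤z)))

ArcOC-pair : ∀ {L X b a c} → b < L → ArcOC X b a → ¬ CycBetween L a c b → c ≢ b → a ≢ b → ArcOC X b c
ArcOC-pair b<L (inj₂ (inj₂ X≡b)) _ _ _ = inj₂ (inj₂ X≡b)
ArcOC-pair {a = a} {c} b<L (inj₁ (X<b , X<a , a≤b)) unstraddled c≢b a≢b with <-cmp a c
... | tri< a<c _ _ = inj₁ (X<b , <-trans X<a a<c , ≮⇒≥ (λ b<c → unstraddled (inj₁ (a<c , ≤∧≢⇒< a≤b a≢b , b<c))))
... | tri≈ _ refl _ = inj₁ (X<b , X<a , a≤b)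
... | tri> _ _ c<a = ⊥-elim (unstraddled (inj₂ (c<a , inj₁ (≤∧≢⇒< a≤b a≢b , b<L))))
ArcOC-pair {a = a} {c} b<L (inj₂ (inj₁ (b<X , a-inside))) unstraddled c≢b a≢b with <-cmp a c
... | tri≈ _ refl _ = inj₂ (inj₁ (b<X , a-inside))
... | tri> _ _ c<a = inj₂ (inj₁ (b<X , inj₂ (≮⇒≥ (λ b<c → unstraddled (inj₂ (c<a , inj₂ b<c))))))
... | tri< a<c _ _ with a-inside
...   | inj₁ X<a = inj₂ (inj₁ (b<X , inj₁ (<-trans X<a a<c)))
...   | inj₂ a≤b = inj₂ (inj₁ (b<X , inj₂ (≮⇒≥ (λ b<c → unstraddled (inj₁ (a<c , ≤∧≢⇒< a≤b a≢b , b<c))))))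

ArcOC-map : ∀ {Y J P y j x} → (Y < P → y < x) → (P ≤ J → x ≤ j) → (Y < J → y < j)
  → (J < Y → j < y) → (Y ≡ J → y ≡ j) → ArcOC Y J P → ArcOC y j x
ArcOC-map YP PJ YJ JY Y≡J (inj₁ (Y<J , Y<P , P≤J))         = inj₁ (YJ Y<J , YP Y<P , PJ P≤J)
ArcOC-map YP PJ YJ JY Y≡J (inj₂ (inj₁ (J<Y , inj₁ Y<P))) = inj₂ (inj₁ (JY J<Y , inj₁ (YP Y<P)))
ArcOC-map YP PJ YJ JY Y≡J (inj₂ (inj₁ (J<Y , inj₂ P≤J))) = inj₂ (inj₁ (JY J<Y , inj₂ (PJ P≤J)))
ArcOC-map YP PJ YJ JY Y≡J (inj₂ (inj₂ eq))               = inj₂ (inj₂ (Y≡J eq))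

ArcOC-transport : ∀ {Y J P y j x} → (Y < P ⇔ y < x) → (P ≤ J ⇔ x ≤ j) → (Y < J ⇔ y < j)
  → (J < Y ⇔ j < y) → (Y ≡ J ⇔ y ≡ j) → ArcOC Y J P ⇔ ArcOC y j x
ArcOC-transport YP PJ YJ JY Y≡J =
  mk⇔ (ArcOC-map (to YP) (to PJ) (to YJ) (to JY) (to Y≡J))
      (ArcOC-map (from YP) (from PJ) (from YJ) (from JY) (from Y≡J))
  where open Equivalence

-- Up to the shift by j, the position of y in the cyclic order j, j + 1, …, n − 1, 0, …, j − 1.
cyclicRank : ℕ → ℕ → ℕ → ℕ
cyclicRank n j y with y <? j
... | yes _ = n + y
... | no _  = y

cyclicRank-ArcOC : ∀ {n y j x} → y < n → ArcOC y j x → x ≢ j → cyclicRank n j y < cyclicRank n j x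
cyclicRank-ArcOC {n} {y} {j} {x} y<n x∈ x≢j with y <? j | x <? j
cyclicRank-ArcOC y<n (inj₁ (_ , y<x , _))           x≢j | yes y<j | yes x<j = +-monoʳ-< _ y<x
cyclicRank-ArcOC y<n (inj₁ (_ , y<x , x≤j))         x≢j | yes y<j | no x≮j  = ⊥-elim (x≮j (≤∧≢⇒< x≤j x≢j))
cyclicRank-ArcOC y<n (inj₂ (inj₁ (j<y , _)))        x≢j | yes y<j | _       = ⊥-elim (<-asym j<y y<j)
cyclicRank-ArcOC y<n (inj₂ (inj₂ refl))             x≢j | yes y<j | _       = ⊥-elim (<-irrefl refl y<j)
cyclicRank-ArcOC {n} y<n x∈                         x≢j | no y≮j  | yes x<j = <-≤-trans y<n (m≤m+n n _)
cyclicRank-ArcOC y<n (inj₁ (y<j , _))               x≢j | no y≮j  | no x≮j  = ⊥-elim (y≮j y<j)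
cyclicRank-ArcOC y<n (inj₂ (inj₁ (j<y , inj₁ y<x))) x≢j | no y≮j  | no x≮j  = y<x
cyclicRank-ArcOC y<n (inj₂ (inj₁ (j<y , inj₂ x≤j))) x≢j | no y≮j  | no x≮j  = ⊥-elim (x≮j (≤∧≢⇒< x≤j x≢j))
cyclicRank-ArcOC y<n (inj₂ (inj₂ refl))             x≢j | no y≮j  | no x≮j  = ≤∧≢⇒< (≮⇒≥ x≮j) (x≢j ∘ sym)

module _ (L : ℕ) (U V : ℕ → Bool) where

  Gap : ℕ → ℕ → Set
  Gap a c = ∀ y → CycBetween L a c y → U y ≡ false × V y ≡ false

  AdjacentPair : Set
  AdjacentPair = ∃ λ a → ∃ λ c → U a ≡ true × V c ≡ true × Gap a c

  adjacentPair-inside : ∀ {a c} → a < c → U a ≡ true → V c ≡ true → AdjacentPair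
  adjacentPair-inside {a} {c} a<c Ua Vc with greatest-below U a c Ua a<c
  ... | a′ , _ , a′<c , Ua′ , U-after with least-between V (suc a′) c a′<c Vc
  ...   | c′ , a′<c′ , c′≤c , Vc′ , V-before = a′ , c′ , Ua′ , Vc′ , gap
    where
    gap : Gap a′ c′
    gap y (inj₁ (_ , a′<y , y<c′)) = U-after y a′<y (<-≤-trans y<c′ c′≤c) , V-before y a′<y y<c′
    gap y (inj₂ (c′<a′ , _))       = ⊥-elim (<-asym a′<c′ c′<a′)

  adjacentPair-around : ∀ {a c} → a < L → (∀ y → y < a → U y ≡ false) → (∀ y → c < y → y < L → V y ≡ false)
    → c < a → U a ≡ true → V c ≡ true → AdjacentPair
  adjacentPair-around {a} {c} a<L U-before V-after c<a Ua Vc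
    with greatest-below U a L Ua a<L | least-between V 0 c z≤n Vc
  ... | a′ , a≤a′ , _ , Ua′ , U-after | c′ , _ , c′≤c , Vc′ , V-before = a′ , c′ , Ua′ , Vc′ , gap
    where
    gap : Gap a′ c′
    gap y (inj₁ (a′<c′ , _)) = ⊥-elim (<⇒≱ (≤-<-trans c′≤c (<-≤-trans c<a a≤a′)) (<⇒≤ a′<c′))
    gap y (inj₂ (_ , inj₁ (a′<y , y<L))) =
      U-after y a′<y y<L , V-after y (<-trans c<a (≤-<-trans a≤a′ a′<y)) y<L
    gap y (inj₂ (_ , inj₂ y<c′)) =
      U-before y (<-trans (<-≤-trans y<c′ c′≤c) c<a) , V-before y z≤n y<c′

  adjacentPair : (∀ p → U p ≡ true → V p ≡ false) → ∀ {a c} → a < L → c < L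
    → U a ≡ true → V c ≡ true → AdjacentPair
  adjacentPair disjoint {a} {c} a<L c<L Ua Vc
    with least-between U 0 a z≤n Ua | greatest-below V c L Vc c<L
  ... | a₀ , _ , a₀≤a , Ua₀ , U-before | c₁ , c≤c₁ , c₁<L , Vc₁ , V-after with <-cmp a₀ c₁
  ...   | tri< a₀<c₁ _ _ = adjacentPair-inside a₀<c₁ Ua₀ Vc₁
  ...   | tri≈ _ refl _  = ⊥-elim (true≢false (trans (sym Vc₁) (disjoint a₀ Ua₀)))
  ...   | tri> _ _ c₁<a₀ = adjacentPair-around (≤-<-trans a₀≤a a<L) (λ y → U-before y z≤n) V-after c₁<a₀ Ua₀ Vc₁

-- Parenthesis matchings

!?-just⇒< : ∀ {A : Set} (xs : List A) p {x} → xs !? p ≡ just x → p < length xs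
!?-just⇒< (y ∷ xs) zero    _ = s≤s z≤n
!?-just⇒< (y ∷ xs) (suc p) e = s≤s (!?-just⇒< xs p e)

!?-<⇒just : ∀ {A : Set} (xs : List A) p → p < length xs → ∃ λ x → xs !? p ≡ just x
!?-<⇒just (y ∷ xs) zero    _         = y , refl
!?-<⇒just (y ∷ xs) (suc p) (s≤s p<L) = !?-<⇒just xs p p<L

CycBetween⇒< : ∀ {L a c y} → c < L → CycBetween L a c y → y < L
CycBetween⇒< c<L (inj₁ (_ , _ , y<c))        = <-trans y<c c<L
CycBetween⇒< c<L (inj₂ (_ , inj₁ (_ , y<L))) = y<L
CycBetween⇒< c<L (inj₂ (_ , inj₂ y<c))       = <-trans y<c c<L

isOpen isClose : Maybe (Paren n) → Bool
isOpen  (just (_ , b)) = b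
isOpen  nothing        = false
isClose (just (_ , b)) = not b
isClose nothing        = false

module Parens (s : List (Paren n)) where

  L : ℕ
  L = length s

  opens closes : ℕ → Bool
  opens  p = isOpen  (s !? p)
  closes p = isClose (s !? p)

  OpenAt⇒opens : ∀ {a} → OpenAt s a → opens a ≡ true
  OpenAt⇒opens (_ , e) rewrite e = refl

  CloseAt⇒closes : ∀ {a} → CloseAt s a → closes a ≡ true
  CloseAt⇒closes (_ , e) rewrite e = refl

  opens⇒OpenAt : ∀ {a} → opens a ≡ true → OpenAt s a
  opens⇒OpenAt {a} h with s !? a
  ... | just (j , true) = j , refl

  closes⇒CloseAt : ∀ {a} → closes a ≡ true → CloseAt s a
  closes⇒CloseAt {a} h with s !? a
  ... | just (j , false) = j , refl

  opens⇒< : ∀ {a} → opens a ≡ true → a < L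
  opens⇒< h = !?-just⇒< s _ (proj₂ (opens⇒OpenAt h))

  closes⇒< : ∀ {a} → closes a ≡ true → a < L
  closes⇒< h = !?-just⇒< s _ (proj₂ (closes⇒CloseAt h))

  closes⇒¬opens : ∀ {p} → closes p ≡ true → opens p ≡ false
  closes⇒¬opens {p} h with s !? p
  ... | just (_ , false) = refl

  opens⇒¬closes : ∀ {p} → opens p ≡ true → closes p ≡ false
  opens⇒¬closes {p} h with s !? p
  ... | just (_ , true) = refl

  opens⊎closes : ∀ p → p < L → opens p ≡ true ⊎ closes p ≡ true
  opens⊎closes p p<L with !?-<⇒just s p p<L
  ... | (_ , b) , e rewrite e with b
  ...   | true  = inj₁ refl
  ...   | false = inj₂ refl

  matched? : ∀ M x → Dec (Matched M x)
  matched? M x = any? (λ ac → (proj₁ ac ≟ x) ⊎-dec (proj₂ ac ≟ x)) M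

  unmatched : Matching → ℕ → Bool
  unmatched M x = not (does (matched? M x))

  unmatched⇒¬Matched : ∀ {M x} → unmatched M x ≡ true → ¬ Matched M x
  unmatched⇒¬Matched {M} {x} h m rewrite dec-true (matched? M x) m = true≢false (sym h)

  ¬Matched⇒unmatched : ∀ {M x} → ¬ Matched M x → unmatched M x ≡ true
  ¬Matched⇒unmatched {M} {x} h rewrite dec-false (matched? M x) h = refl

  ¬unmatched⇒Matched : ∀ {M x} → unmatched M x ≡ false → Matched M x
  ¬unmatched⇒Matched {M} {x} h with matched? M x
  ... | yes m = m

  unmatched-cons : ∀ M a c x → x ≢ a → x ≢ c → unmatched ((a , c) ∷ M) x ≡ unmatched M x
  unmatched-cons M a c x x≢a x≢c =
    cong not (does-⇔ (matched? ((a , c) ∷ M) x) (matched? M x) (mk⇔ drop-head there))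
    where
    drop-head : Matched ((a , c) ∷ M) x → Matched M x
    drop-head (here (inj₁ a≡x)) = ⊥-elim (x≢a (sym a≡x))
    drop-head (here (inj₂ c≡x)) = ⊥-elim (x≢c (sym c≡x))
    drop-head (there m)         = m

  unmatched-swap : ∀ M a c x → unmatched ((a , c) ∷ M) x ≡ unmatched ((c , a) ∷ M) x
  unmatched-swap M a c x = cong not (does-⇔ (matched? ((a , c) ∷ M) x) (matched? ((c , a) ∷ M) x) (mk⇔ swap swap))
    where
    swap : ∀ {a c} → Matched ((a , c) ∷ M) x → Matched ((c , a) ∷ M) x
    swap (here (inj₁ e)) = here (inj₂ e)
    swap (here (inj₂ e)) = here (inj₁ e)
    swap (there m)       = there m

  unmatched-cons-outside : (P : ℕ → Bool) (M : Matching) {a c : ℕ} → P c ≡ false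
    → ∀ x → x ≢ a → ind ((P ∩ unmatched ((a , c) ∷ M)) x) ≡ ind ((P ∩ unmatched M) x)
  unmatched-cons-outside P M {a} {c} Pc x x≢a with x ≟ c
  ... | yes refl rewrite Pc = refl
  ... | no x≢c   = cong (λ t → ind (P x ∧ t)) (unmatched-cons M a c x x≢a x≢c)

  #unmatched-cons : (P : ℕ → Bool) (M : Matching) {a c : ℕ} → a < L → ¬ Matched M a → P c ≡ false
    → #< L (P ∩ unmatched M) ≡ ind (P a) + #< L (P ∩ unmatched ((a , c) ∷ M))
  #unmatched-cons P M {a} {c} a<L a-free Pc with P a in Pa
  ... | true  = ∑<-insert L _ _ a a<L (λ x _ x≢a → unmatched-cons-outside P M {a} Pc x x≢a) at-a
    where
    at-a : ind ((P ∩ unmatched M) a) ≡ suc (ind ((P ∩ unmatched ((a , c) ∷ M)) a))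
    at-a rewrite Pa | ¬Matched⇒unmatched {M} a-free
               | dec-true (matched? ((a , c) ∷ M) a) (here (inj₁ refl)) = refl
  ... | false = ∑<-cong L (λ x _ → everywhere x)
    where
    everywhere : ∀ x → ind ((P ∩ unmatched M) x) ≡ ind ((P ∩ unmatched ((a , c) ∷ M)) x)
    everywhere x with x ≟ a
    ... | yes refl rewrite Pa = refl
    ... | no x≢a   = sym (unmatched-cons-outside P M {a} Pc x x≢a)

  #opens #closes : (ℕ → Bool) → ℕ
  #opens  I = #< L (opens ∩ I)
  #closes I = #< L (closes ∩ I)

  #unmatchedOpens #unmatchedCloses : (ℕ → Bool) → Matching → ℕ
  #unmatchedOpens  I M = #< L ((opens ∩ I) ∩ unmatched M)
  #unmatchedCloses I M = #< L ((closes ∩ I) ∩ unmatched M)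

  #unmatched-[] : ∀ P → #< L (P ∩ unmatched []) ≡ #< L P
  #unmatched-[] P = ∑<-cong L (λ x _ → cong ind (∧-identityʳ (P x)))

  module _ {M a c} (a-open : opens a ≡ true) (c-close : closes c ≡ true)
           (a-free : ¬ Matched M a) (c-free : ¬ Matched M c) (I : ℕ → Bool) where

    #unmatchedOpens-step : #unmatchedOpens I M ≡ ind (I a) + #unmatchedOpens I ((a , c) ∷ M)
    #unmatchedOpens-step =
      trans (#unmatched-cons (opens ∩ I) M (opens⇒< a-open) a-free (cong (_∧ I c) (closes⇒¬opens c-close)))
            (cong (λ t → ind (t ∧ I a) + #unmatchedOpens I ((a , c) ∷ M)) a-open)

    #unmatchedCloses-step : #unmatchedCloses I M ≡ ind (I c) + #unmatchedCloses I ((a , c) ∷ M)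
    #unmatchedCloses-step = begin
      #unmatchedCloses I M
        ≡⟨ #unmatched-cons (closes ∩ I) M (closes⇒< c-close) c-free (cong (_∧ I a) (opens⇒¬closes a-open)) ⟩
      ind ((closes ∩ I) c) + #< L ((closes ∩ I) ∩ unmatched ((c , a) ∷ M))
        ≡⟨ cong₂ _+_ (cong (λ t → ind (t ∧ I c)) c-close)
                     (∑<-cong L (λ x _ → cong (ind ∘ ((closes ∩ I) x ∧_)) (unmatched-swap M c a x))) ⟩
      ind (I c) + #unmatchedCloses I ((a , c) ∷ M)
        ∎
      where open ≡-Reasoning

  Star-invariant : (P : Matching → Set) → (∀ {M M′} → Step s M M′ → P M → P M′)
    → ∀ {M M′} → Star (Step s) M M′ → P M → P M′
  Star-invariant P pres ε         = id
  Star-invariant P pres (st ◅ st′) = Star-invariant P pres st′ ∘ pres st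

  everywhere : ℕ → Bool
  everywhere _ = true

  Balanced : Matching → Set
  Balanced M = #unmatchedCloses everywhere M + #opens everywhere ≡ #unmatchedOpens everywhere M + #closes everywhere

  balanced : ∀ {M} → Star (Step s) [] M → Balanced M
  balanced steps = Star-invariant Balanced preserve steps initially
    where
    open ≡-Reasoning
    O = #opens everywhere
    C = #closes everywhere
    initially : Balanced []
    initially = begin
      #unmatchedCloses everywhere [] + O ≡⟨ cong (_+ O) (#unmatched-[] (closes ∩ everywhere)) ⟩
      C + O                              ≡⟨ +-comm C O ⟩
      O + C                              ≡⟨ cong (_+ C) (#unmatched-[] (opens ∩ everywhere)) ⟨
      #unmatchedOpens everywhere [] + C  ∎
    preserve : ∀ {M M′} → Step s M M′ → Balanced M → Balanced M′
    preserve {M} (step a c a-open c-close a-free c-free _) bal = suc-injective (begin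
      suc (#unmatchedCloses everywhere M′ + O) ≡⟨ cong (_+ O) (#unmatchedCloses-step ao cc a-free c-free everywhere) ⟨
      #unmatchedCloses everywhere M + O        ≡⟨ bal ⟩
      #unmatchedOpens everywhere M + C         ≡⟨ cong (_+ C) (#unmatchedOpens-step ao cc a-free c-free everywhere) ⟩
      suc (#unmatchedOpens everywhere M′ + C)  ∎)
      where
      M′ = (a , c) ∷ M
      ao = OpenAt⇒opens a-open
      cc = CloseAt⇒closes c-close

  arc : ℕ → ℕ → ℕ → Bool
  arc X b p = does (arcOC? X b p)

  module Final {M : Matching} (final : FinalMatching s M) (enough : #opens everywhere ≤ #closes everywhere) where

    free-opens free-closes : ℕ → Bool
    free-opens  = (opens ∩ everywhere) ∩ unmatched M
    free-closes = (closes ∩ everywhere) ∩ unmatched M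

    free-opens⇒opens : ∀ {p} → free-opens p ≡ true → opens p ≡ true
    free-opens⇒opens h = ∧-conicalˡ _ _ (∧-conicalˡ _ _ h)

    free-closes⇒closes : ∀ {p} → free-closes p ≡ true → closes p ≡ true
    free-closes⇒closes h = ∧-conicalˡ _ _ (∧-conicalˡ _ _ h)

    free⇒¬Matched : ∀ {P : ℕ → Bool} {p} → (P ∩ unmatched M) p ≡ true → ¬ Matched M p
    free⇒¬Matched {P} h = unmatched⇒¬Matched (∧-conicalʳ (P _) _ h)

    not-free⇒Matched : ∀ {P : ℕ → Bool} {p} → P p ≡ true → (P ∩ unmatched M) p ≡ false → Matched M p
    not-free⇒Matched {P} Pp h rewrite Pp = ¬unmatched⇒Matched h

    gap⇒Matched : ∀ {a c} → c < L → Gap L free-opens free-closes a c → ∀ y → CycBetween L a c y → Matched M y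
    gap⇒Matched c<L gap y between with opens⊎closes y (CycBetween⇒< c<L between)
    ... | inj₁ y-open  = not-free⇒Matched {opens ∩ everywhere} (cong (_∧ true) y-open) (proj₁ (gap y between))
    ... | inj₂ y-close = not-free⇒Matched {closes ∩ everywhere} (cong (_∧ true) y-close) (proj₂ (gap y between))

    free-close-exists : ∀ {a} → free-opens a ≡ true → ∃ λ c → c < L × free-closes c ≡ true
    free-close-exists {a} a-free = #<-witness L free-closes (+-cancelʳ-≤ (#opens everywhere) 1 _ more)
      where
      more : 1 + #opens everywhere ≤ #unmatchedCloses everywhere M + #opens everywhere
      more = begin
        1 + #opens everywhere
          ≤⟨ +-mono-≤ (#<-member L free-opens a (opens⇒< (free-opens⇒opens a-free)) a-free) enough ⟩
        #unmatchedOpens everywhere M + #closes everywhere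
          ≡⟨ balanced (proj₁ final) ⟨
        #unmatchedCloses everywhere M + #opens everywhere
          ∎
        where open ≤-Reasoning

    -- By the balance an unmatched "(" forces an unmatched ")", and an adjacent pair of such
    -- parentheses could still be matched.
    no-free-opens : ∀ {a} → free-opens a ≡ true → ⊥
    no-free-opens {a} a-free with free-close-exists a-free
    ... | c , c<L , c-free =
      stuck (adjacentPair L free-opens free-closes disjoint (opens⇒< (free-opens⇒opens a-free)) c<L a-free c-free)
      where
      disjoint : ∀ p → free-opens p ≡ true → free-closes p ≡ false
      disjoint p h rewrite opens⇒¬closes (free-opens⇒opens h) = refl
      stuck : AdjacentPair L free-opens free-closes → ⊥
      stuck (a′ , c′ , a′-free , c′-free , gap) = proj₂ final _
        (step a′ c′ (opens⇒OpenAt (free-opens⇒opens a′-free)) (closes⇒CloseAt c′-close)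
              (free⇒¬Matched {opens ∩ everywhere} a′-free) (free⇒¬Matched {closes ∩ everywhere} c′-free)
              (gap⇒Matched (closes⇒< c′-close) gap))
        where
        c′-close = free-closes⇒closes c′-free

    open⇒Matched : ∀ {a} → opens a ≡ true → Matched M a
    open⇒Matched {a} a-open with matched? M a
    ... | yes m     = m
    ... | no a-free =
      ⊥-elim (no-free-opens (trans (cong (λ t → (t ∧ true) ∧ unmatched M a) a-open) (¬Matched⇒unmatched a-free)))

    module _ {b : ℕ} (b-close : closes b ≡ true) (b-free : ¬ Matched M b) (X : ℕ) where

      private
        I : ℕ → Bool
        I = arc X b

      Surplus : Matching → Set
      Surplus M′ = ¬ Matched M′ b → #unmatchedCloses I M′ + #opens I ≤ #closes I + #unmatchedOpens I M′

      -- A pair matched while b is unmatched cannot straddle b, so its closer lies in (X, b]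
      -- whenever its opener does.
      surplus-step : ∀ {M₀ M₁} → Step s M₀ M₁ → Surplus M₀ → Surplus M₁
      surplus-step {M₀} (step a c a-open c-close a-free c-free between) ih b-free₁ =
        +-cancelˡ-≤ (ind (I c)) _ _ (begin
          ind (I c) + (#unmatchedCloses I M₁ + #opens I) ≡⟨ +-assoc (ind (I c)) _ _ ⟨
          (ind (I c) + #unmatchedCloses I M₁) + #opens I ≡⟨ cong (_+ #opens I) (#unmatchedCloses-step ao cc a-free c-free I) ⟨
          #unmatchedCloses I M₀ + #opens I               ≤⟨ ih b-free₀ ⟩
          #closes I + #unmatchedOpens I M₀               ≡⟨ cong (#closes I +_) (#unmatchedOpens-step ao cc a-free c-free I) ⟩
          #closes I + (ind (I a) + #unmatchedOpens I M₁) ≤⟨ +-monoʳ-≤ (#closes I) (+-monoˡ-≤ _ (ind-mono a⇒c)) ⟩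
          #closes I + (ind (I c) + #unmatchedOpens I M₁) ≡⟨ x∙yz≈y∙xz (#closes I) (ind (I c)) _ ⟩
          ind (I c) + (#closes I + #unmatchedOpens I M₁) ∎)
        where
        open ≤-Reasoning
        M₁ = (a , c) ∷ M₀
        ao = OpenAt⇒opens a-open
        cc = CloseAt⇒closes c-close
        b-free₀ : ¬ Matched M₀ b
        b-free₀ = b-free₁ ∘ there
        a⇒c : I a ≡ true → I c ≡ true
        a⇒c Ia = dec-true (arcOC? X b c)
          (ArcOC-pair (closes⇒< b-close) (does⇒ (arcOC? X b a) Ia) (b-free₀ ∘ between b)
            (λ c≡b → b-free₁ (here (inj₂ c≡b))) (λ a≡b → b-free₁ (here (inj₁ a≡b))))

      unmatched-close-surplus : suc (#opens I) ≤ #closes I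
      unmatched-close-surplus = begin
        1 + #opens I                        ≤⟨ +-monoˡ-≤ (#opens I) (#<-member L _ b (closes⇒< b-close) b-unmatched) ⟩
        #unmatchedCloses I M + #opens I     ≤⟨ Star-invariant Surplus surplus-step (proj₁ final) initially b-free ⟩
        #closes I + #unmatchedOpens I M     ≡⟨ cong (#closes I +_) no-unmatched-opens ⟩
        #closes I + 0                       ≡⟨ +-identityʳ _ ⟩
        #closes I                           ∎
        where
        open ≤-Reasoning
        initially : Surplus []
        initially _ = ≤-reflexive (cong₂ _+_ (#unmatched-[] (closes ∩ I)) (sym (#unmatched-[] (opens ∩ I))))
        b-unmatched : ((closes ∩ I) ∩ unmatched M) b ≡ true
        b-unmatched rewrite b-close | dec-true (arcOC? X b b) (ArcOC-end X b) = ¬Matched⇒unmatched b-free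
        no-unmatched-opens : #unmatchedOpens I M ≡ 0
        no-unmatched-opens = ∑<-zero L _ none
          where
          none : ∀ x → x < L → ind (((opens ∩ I) ∩ unmatched M) x) ≡ 0
          none x _ with opens x in x-open
          ... | false = refl
          ... | true rewrite dec-true (matched? M x) (open⇒Matched x-open) = cong ind (∧-zeroʳ (I x))

-- The parenthesis system of a set of sites

module _ {B : Set} where

  blocks : (Fin n → List B) → List B
  blocks {zero}  f = []
  blocks {suc n} f = f zero ++ blocks (f ∘ suc)

  blockStart : (Fin n → List B) → Fin n → ℕ
  blockStart f zero    = 0
  blockStart f (suc x) = length (f zero) + blockStart (f ∘ suc) x

  concatMap-tabulate : ∀ {C : Set} (f : C → List B) (g : Fin n → C) → concatMap f (List.tabulate g) ≡ blocks (f ∘ g)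
  concatMap-tabulate {zero}  f g = refl
  concatMap-tabulate {suc n} f g = cong (f (g zero) ++_) (concatMap-tabulate f (g ∘ suc))

  !?-++ˡ : ∀ (xs ys : List B) d → d < length xs → (xs ++ ys) !? d ≡ xs !? d
  !?-++ˡ (x ∷ xs) ys zero    _         = refl
  !?-++ˡ (x ∷ xs) ys (suc d) (s≤s d<L) = !?-++ˡ xs ys d d<L

  !?-++ʳ : ∀ (xs ys : List B) d → (xs ++ ys) !? (length xs + d) ≡ ys !? d
  !?-++ʳ []       ys d = refl
  !?-++ʳ (x ∷ xs) ys d = !?-++ʳ xs ys d

  !?-blocks : (f : Fin n → List B) (x : Fin n) (d : ℕ) → d < length (f x) → blocks f !? (blockStart f x + d) ≡ f x !? d
  !?-blocks f zero    d d<L = !?-++ˡ (f zero) _ d d<L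
  !?-blocks f (suc x) d d<L = begin
    blocks f !? ((length (f zero) + blockStart (f ∘ suc) x) + d) ≡⟨ cong (blocks f !?_) (+-assoc (length (f zero)) _ d) ⟩
    blocks f !? (length (f zero) + (blockStart (f ∘ suc) x + d)) ≡⟨ !?-++ʳ (f zero) _ _ ⟩
    blocks (f ∘ suc) !? (blockStart (f ∘ suc) x + d)             ≡⟨ !?-blocks (f ∘ suc) x d d<L ⟩
    f (suc x) !? d                                                    ∎
    where open ≡-Reasoning

  ∑<-blocks : (f : Fin n → List B) (G : ℕ → ℕ) →
    ∑< (length (blocks f)) G ≡ ∑ (λ x → ∑< (length (f x)) (λ d → G (blockStart f x + d)))
  ∑<-blocks {zero}  f G = refl
  ∑<-blocks {suc n} f G = begin
    ∑< (length (f₀ ++ blocks (f ∘ suc))) G                                  ≡⟨ cong (λ l → ∑< l G) (length-++ f₀) ⟩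
    ∑< (length f₀ + length (blocks (f ∘ suc))) G                            ≡⟨ ∑<-+ (length f₀) _ G ⟩
    ∑< (length f₀) G + ∑< (length (blocks (f ∘ suc))) (λ d → G (length f₀ + d))
      ≡⟨ cong (∑< (length f₀) G +_) (trans (∑<-blocks (f ∘ suc) _) (∑-cong shift)) ⟩
    ∑< (length f₀) G + ∑ (λ x → ∑< (length (f (suc x))) (λ d → G (blockStart f (suc x) + d))) ∎
    where
    open ≡-Reasoning
    f₀ = f zero
    shift : ∀ x → ∑< (length (f (suc x))) (λ d → G (length f₀ + (blockStart (f ∘ suc) x + d)))
                ≡ ∑< (length (f (suc x))) (λ d → G (blockStart f (suc x) + d))
    shift x = ∑<-cong (length (f (suc x))) (λ d _ → cong G (sym (+-assoc (length f₀) (blockStart (f ∘ suc) x) d)))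

  blockStart-mono : (f : Fin n → List B) (x y : Fin n) → toℕ x < toℕ y → blockStart f x + length (f x) ≤ blockStart f y
  blockStart-mono f zero    (suc y) _         = m≤m+n _ _
  blockStart-mono f (suc x) (suc y) (s≤s x<y) = begin
    (length (f zero) + blockStart (f ∘ suc) x) + length (f (suc x)) ≡⟨ +-assoc (length (f zero)) _ _ ⟩
    length (f zero) + (blockStart (f ∘ suc) x + length (f (suc x))) ≤⟨ +-monoʳ-≤ _ (blockStart-mono (f ∘ suc) x y x<y) ⟩
    length (f zero) + blockStart (f ∘ suc) y                             ∎
    where open ≤-Reasoning

siteArc : Fin n → Fin n → Fin n → Bool
siteArc y j x = does (arcOC? (toℕ y) (toℕ j) (toℕ x))

module SiteParens (A Q : Subset n) where

  open Parens (parens A Q)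

  block : Fin n → List (Paren n)
  block = contrib A Q

  parens≡blocks : parens A Q ≡ blocks block
  parens≡blocks = concatMap-tabulate block id

  length-block : ∀ x → length (block x) ≡ ind (lookup A x) + ind (lookup Q x)
  length-block x with lookup A x | lookup Q x
  ... | true  | true  = refl
  ... | true  | false = refl
  ... | false | true  = refl
  ... | false | false = refl

  #opens-block : ∀ x c → ∑< (length (block x)) (λ d → ind (isOpen (block x !? d) ∧ c)) ≡ ind (lookup A x ∧ c)
  #opens-block x c with lookup A x | lookup Q x
  ... | true  | true  = +-identityʳ _
  ... | true  | false = refl
  ... | false | true  = refl
  ... | false | false = refl

  #closes-block : ∀ x c → ∑< (length (block x)) (λ d → ind (isClose (block x !? d) ∧ c)) ≡ ind (lookup Q x ∧ c)
  #closes-block x c with lookup A x | lookup Q x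
  ... | true  | true  = refl
  ... | true  | false = +-identityʳ _
  ... | false | true  = refl
  ... | false | false = refl

  closePos : Fin n → ℕ
  closePos x = blockStart block x + ind (lookup A x)

  closePos-in-block : ∀ {x} → lookup Q x ≡ true → ind (lookup A x) < length (block x)
  closePos-in-block {x} x∈Q rewrite length-block x | x∈Q = m<m+n _ (s≤s z≤n)

  parens-closePos : ∀ {x} → lookup Q x ≡ true → parens A Q !? closePos x ≡ just (x , false)
  parens-closePos {x} x∈Q rewrite parens≡blocks = trans (!?-blocks block x _ (closePos-in-block x∈Q)) (block-close x∈Q)
    where
    block-close : lookup Q x ≡ true → block x !? ind (lookup A x) ≡ just (x , false)
    block-close x∈Q with lookup A x | lookup Q x
    block-close refl | true  | true = refl
    block-close refl | false | true = refl

  module _ (I : ℕ → Bool) (J : Fin n → Bool)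
           (I≡J : ∀ x d → d < length (block x) → I (blockStart block x + d) ≡ J x) where

    #opens-sites : #opens I ≡ # (lookup A ∩ J)
    #opens-sites rewrite parens≡blocks = trans (∑<-blocks block _) (∑-cong λ x →
      trans (∑<-cong (length (block x)) (λ d d<L → cong₂ (λ o i → ind (isOpen o ∧ i)) (!?-blocks block x d d<L) (I≡J x d d<L)))
            (#opens-block x (J x)))

    #closes-sites : #closes I ≡ # (lookup Q ∩ J)
    #closes-sites rewrite parens≡blocks = trans (∑<-blocks block _) (∑-cong λ x →
      trans (∑<-cong (length (block x)) (λ d d<L → cong₂ (λ o i → ind (isClose o ∧ i)) (!?-blocks block x d d<L) (I≡J x d d<L)))
            (#closes-block x (J x)))

  InBlock : ℕ → Fin n → Set
  InBlock P x = ∃ λ d → d < length (block x) × P ≡ blockStart block x + d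

  closePos-InBlock : ∀ {x} → lookup Q x ≡ true → InBlock (closePos x) x
  closePos-InBlock x∈Q = _ , closePos-in-block x∈Q , refl

  InBlock-< : ∀ {P₁ P₂ x₁ x₂} → InBlock P₁ x₁ → InBlock P₂ x₂ → toℕ x₁ < toℕ x₂ → P₁ < P₂
  InBlock-< {x₁ = x₁} {x₂} (d₁ , d₁<L , refl) (d₂ , _ , refl) x₁<x₂ =
    <-≤-trans (+-monoʳ-< (blockStart block x₁) d₁<L) (≤-trans (blockStart-mono block x₁ x₂ x₁<x₂) (m≤m+n _ _))

  -- ")" is the last parenthesis of its block.
  InBlock-≤-closePos : ∀ {P x w} → InBlock P x → lookup Q w ≡ true → toℕ x ≤ toℕ w → P ≤ closePos w
  InBlock-≤-closePos {P} {x} {w} P∈x w∈Q x≤w with m≤n⇒m<n∨m≡n x≤w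
  ... | inj₁ x<w = <⇒≤ (InBlock-< P∈x (closePos-InBlock w∈Q) x<w)
  ... | inj₂ x≡w with Fin.toℕ-injective x≡w
  InBlock-≤-closePos {P} {x} {.x} (d , d<L , refl) x∈Q _ | inj₂ _ | refl =
    +-monoʳ-≤ (blockStart block x) (≤-pred (subst (d <_) length≡ d<L))
    where
    length≡ : length (block x) ≡ suc (ind (lookup A x))
    length≡ = trans (length-block x) (trans (cong (λ t → ind (lookup A x) + ind t) x∈Q) (+-comm (ind (lookup A x)) 1))

  closePos-<⇔ : ∀ {P x w} → lookup Q w ≡ true → InBlock P x → (closePos w < P ⇔ toℕ w < toℕ x)
  closePos-<⇔ w∈Q P∈x =
    mk⇔ (λ w<P → ≰⇒> (λ x≤w → <⇒≱ w<P (InBlock-≤-closePos P∈x w∈Q x≤w))) (InBlock-< (closePos-InBlock w∈Q) P∈x)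

  ≤-closePos⇔ : ∀ {P x w} → lookup Q w ≡ true → InBlock P x → (P ≤ closePos w ⇔ toℕ x ≤ toℕ w)
  ≤-closePos⇔ w∈Q P∈x =
    mk⇔ (λ P≤w → ≮⇒≥ (λ w<x → <⇒≱ (Equivalence.from (closePos-<⇔ w∈Q P∈x) w<x) P≤w)) (InBlock-≤-closePos P∈x w∈Q)

  closePos-≡⇔ : ∀ {y j} → lookup Q y ≡ true → lookup Q j ≡ true → (closePos y ≡ closePos j ⇔ toℕ y ≡ toℕ j)
  closePos-≡⇔ {y} {j} y∈Q j∈Q = mk⇔ same-site (cong closePos ∘ Fin.toℕ-injective)
    where
    same-site : closePos y ≡ closePos j → toℕ y ≡ toℕ j
    same-site eq with <-cmp (toℕ y) (toℕ j)
    ... | tri< y<j _ _ = ⊥-elim (<-irrefl eq (InBlock-< (closePos-InBlock y∈Q) (closePos-InBlock j∈Q) y<j))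
    ... | tri≈ _ y≡j _ = y≡j
    ... | tri> _ _ j<y = ⊥-elim (<-irrefl (sym eq) (InBlock-< (closePos-InBlock j∈Q) (closePos-InBlock y∈Q) j<y))

  arc-closePos : ∀ {y j P x} → lookup Q y ≡ true → lookup Q j ≡ true → InBlock P x
    → arc (closePos y) (closePos j) P ≡ siteArc y j x
  arc-closePos y∈Q j∈Q P∈x = does-⇔ (arcOC? _ _ _) (arcOC? _ _ _)
    (ArcOC-transport (closePos-<⇔ y∈Q P∈x) (≤-closePos⇔ j∈Q P∈x) (closePos-<⇔ y∈Q (closePos-InBlock j∈Q))
                     (closePos-<⇔ j∈Q (closePos-InBlock y∈Q)) (closePos-≡⇔ y∈Q j∈Q))

  #opens-everywhere : #opens everywhere ≡ ∣ A ∣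
  #opens-everywhere = trans (#opens-sites everywhere (λ _ → true) (λ _ _ _ → refl))
                            (trans (#-cong (∧-identityʳ ∘ lookup A)) (sym (∣∣≡# A)))

  #closes-everywhere : #closes everywhere ≡ ∣ Q ∣
  #closes-everywhere = trans (#closes-sites everywhere (λ _ → true) (λ _ _ _ → refl))
                             (trans (#-cong (∧-identityʳ ∘ lookup Q)) (sym (∣∣≡# Q)))

  unmatched-close-site-surplus : ∀ {M y j} → FinalMatching (parens A Q) M → ∣ A ∣ ≤ ∣ Q ∣
    → lookup Q y ≡ true → lookup Q j ≡ true → ¬ Matched M (closePos j)
    → suc (# (lookup A ∩ siteArc y j)) ≤ # (lookup Q ∩ siteArc y j)
  unmatched-close-site-surplus {M} {y} {j} final A≤Q y∈Q j∈Q j-free =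
    subst₂ (λ o c → suc o ≤ c) (#opens-sites I (siteArc y j) I≡J) (#closes-sites I (siteArc y j) I≡J)
      (Final.unmatched-close-surplus final enough (CloseAt⇒closes (j , parens-closePos j∈Q)) j-free (closePos y))
    where
    I = arc (closePos y) (closePos j)
    I≡J : ∀ x d → d < length (block x) → I (blockStart block x + d) ≡ siteArc y j x
    I≡J x d d<L = arc-closePos y∈Q j∈Q (d , d<L , refl)
    enough : #opens everywhere ≤ #closes everywhere
    enough = subst₂ _≤_ (sym #opens-everywhere) (sym #closes-everywhere) A≤Q

-- Greedy filling along the cyclic orders

take-+ : ∀ {A : Set} k d (xs : List A) → take (k + d) xs ≡ take k xs ++ take d (drop k xs)
take-+ zero    d       xs       = refl
take-+ (suc k) zero    []       = refl
take-+ (suc k) (suc d) []       = refl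
take-+ (suc k) d       (x ∷ xs) = cong (x ∷_) (take-+ k d xs)

length-take-≤ : ∀ {A : Set} k (xs : List A) → k ≤ length xs → length (take k xs) ≡ k
length-take-≤ k xs k≤ = trans (length-take k xs) (m≤n⇒m⊓n≡m k≤)

first-just : ∀ {A : Set} (P : A → Bool) xs {x} → first P xs ≡ just x → P x ≡ true × x ∈ xs
first-just P (y ∷ xs) e with P y in Py
first-just P (y ∷ xs) refl | true  = Py , here refl
...                        | false = map₂ there (first-just P xs e)

first-nothing : ∀ {A : Set} (P : A → Bool) xs → first P xs ≡ nothing → ∀ {x} → x ∈ xs → P x ≡ false
first-nothing P (y ∷ xs) e x∈ with P y in Py
first-nothing P (y ∷ xs) () x∈          | true
first-nothing P (y ∷ xs) e (here refl)  | false = Py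
first-nothing P (y ∷ xs) e (there x∈)  | false = first-nothing P xs e x∈

first-++ : ∀ {A : Set} (P : A → Bool) xs ys {j} → first P (xs ++ ys) ≡ just j →
  first P xs ≡ just j ⊎ (first P xs ≡ nothing × first P ys ≡ just j)
first-++ P []       ys e = inj₂ (refl , e)
first-++ P (x ∷ xs) ys e with P x
... | true  = inj₁ e
... | false = first-++ P xs ys e

Ascending : ∀ {n} → List (Fin n) → Set
Ascending = AllPairs (λ a b → toℕ a < toℕ b)

first-ascending : ∀ (P : Fin n → Bool) xs {j} → Ascending xs →
  first P xs ≡ just j → ∀ {x} → x ∈ xs → toℕ x < toℕ j → P x ≡ false
first-ascending P (y ∷ xs) (y< ∷ asc) e x∈ x<j with P y in Py
first-ascending P (y ∷ xs) (y< ∷ asc) refl (here refl) x<j | true  = ⊥-elim (<-irrefl refl x<j)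
first-ascending P (y ∷ xs) (y< ∷ asc) refl (there x∈)  x<j | true  = ⊥-elim (<-asym x<j (All.lookup y< x∈))
first-ascending P (y ∷ xs) (y< ∷ asc) e    (here refl) x<j | false = Py
first-ascending P (y ∷ xs) (y< ∷ asc) e    (there x∈)  x<j | false = first-ascending P xs asc e x∈ x<j

tabulate-ascending : ∀ {m} (f : Fin n → Fin m) → (∀ a b → toℕ a < toℕ b → toℕ (f a) < toℕ (f b)) →
  Ascending (List.tabulate f)
tabulate-ascending {zero}  f mono = []
tabulate-ascending {suc n} f mono =
  AllP.tabulate⁺ (λ x → mono zero (suc x) (s≤s z≤n))
  ∷ tabulate-ascending (f ∘ suc) (λ a b a<b → mono (suc a) (suc b) (s≤s a<b))

allFin-ascending : ∀ n → Ascending (allFin n)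
allFin-ascending n = tabulate-ascending id (λ _ _ a<b → a<b)

drop-tabulate-All : ∀ {B : Set} (P : B → Set) (f : Fin n → B) i → (∀ x → i ≤ toℕ x → P (f x)) →
  All P (drop i (List.tabulate f))
drop-tabulate-All         P f zero    h = AllP.tabulate⁺ (λ x → h x z≤n)
drop-tabulate-All {zero}  P f (suc i) h = []
drop-tabulate-All {suc n} P f (suc i) h = drop-tabulate-All P (f ∘ suc) i (λ x i≤x → h (suc x) (s≤s i≤x))

take-tabulate-All : ∀ {B : Set} (P : B → Set) (f : Fin n → B) i → (∀ x → toℕ x < i → P (f x)) →
  All P (take i (List.tabulate f))
take-tabulate-All         P f zero    h = []
take-tabulate-All {zero}  P f (suc i) h = []
take-tabulate-All {suc n} P f (suc i) h =
  h zero (s≤s z≤n) ∷ take-tabulate-All P (f ∘ suc) i (λ x x<i → h (suc x) (s≤s x<i))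

module _ {n : ℕ} (i : ℕ) where

  private
    D T : List (Fin n)
    D = drop i (allFin n)
    T = take i (allFin n)

  ∈-drop-allFin⇒ : ∀ {x} → x ∈ D → i ≤ toℕ x
  ∈-drop-allFin⇒ = All.lookup (drop-tabulate-All (λ x → i ≤ toℕ x) id i (λ _ i≤x → i≤x))

  ∈-take-allFin⇒ : ∀ {x} → x ∈ T → toℕ x < i
  ∈-take-allFin⇒ = All.lookup (take-tabulate-All (λ x → toℕ x < i) id i (λ _ x<i → x<i))

  ∈-take⊎drop-allFin : ∀ x → x ∈ T ⊎ x ∈ D
  ∈-take⊎drop-allFin x = ∈-++⁻ T (subst (x ∈_) (sym (take++drop≡id i (allFin n))) (∈-allFin x))

  ∈-drop-allFin⇐ : ∀ {x} → i ≤ toℕ x → x ∈ D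
  ∈-drop-allFin⇐ {x} i≤x with ∈-take⊎drop-allFin x
  ... | inj₁ x∈T = ⊥-elim (<⇒≱ (∈-take-allFin⇒ x∈T) i≤x)
  ... | inj₂ x∈D = x∈D

  ∈-take-allFin⇐ : ∀ {x} → toℕ x < i → x ∈ T
  ∈-take-allFin⇐ {x} x<i with ∈-take⊎drop-allFin x
  ... | inj₁ x∈T = x∈T
  ... | inj₂ x∈D = ⊥-elim (<⇒≱ x<i (∈-drop-allFin⇒ x∈D))

∈-rightOrder : (i x : Fin n) → x ∈ rightOrder i
∈-rightOrder {n} i x with ∈-take⊎drop-allFin {n} (toℕ i) x
... | inj₁ x∈T = ∈-++⁺ʳ (drop (toℕ i) (allFin n)) x∈T
... | inj₂ x∈D = ∈-++⁺ˡ x∈D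

∈-leftOrder : (i x : Fin n) → x ∈ leftOrder i
∈-leftOrder {n} i x with ∈-take⊎drop-allFin {n} (suc (toℕ i)) x
... | inj₁ x∈T = ∈-++⁺ˡ (AnyP.reverse⁺ x∈T)
... | inj₂ x∈D = ∈-++⁺ʳ (reverse (take (suc (toℕ i)) (allFin n))) (AnyP.reverse⁺ x∈D)

first-rightOrder : (P : Fin n → Bool) (i j : Fin n) → first P (rightOrder i) ≡ just j →
  ∀ x → ArcCO (toℕ i) (toℕ j) (toℕ x) → P x ≡ false
first-rightOrder {n} P i j e x x∈ with first-++ P (drop (toℕ i) (allFin n)) (take (toℕ i) (allFin n)) e | x∈
... | inj₁ eD | inj₁ (_ , i≤x , x<j) =
  first-ascending P _ (APP.drop⁺ (toℕ i) (allFin-ascending n)) eD (∈-drop-allFin⇐ (toℕ i) i≤x) x<j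
... | inj₁ eD | inj₂ (j<i , _) = ⊥-elim (<⇒≱ j<i (∈-drop-allFin⇒ (toℕ i) (proj₂ (first-just P _ eD))))
... | inj₂ (eD , eT) | inj₁ (i≤j , _) = ⊥-elim (<⇒≱ (∈-take-allFin⇒ (toℕ i) (proj₂ (first-just P _ eT))) i≤j)
... | inj₂ (eD , eT) | inj₂ (_ , inj₁ i≤x) = first-nothing P _ eD (∈-drop-allFin⇐ (toℕ i) i≤x)
... | inj₂ (eD , eT) | inj₂ (j<i , inj₂ x<j) =
  first-ascending P _ (APP.take⁺ (toℕ i) (allFin-ascending n)) eT (∈-take-allFin⇐ (toℕ i) (<-trans x<j j<i)) x<j

setAt-same : (v : Partial n) (j : Fin n) (c : ℕ) → setAt v j c j ≡ just c
setAt-same v j c rewrite dec-true (j Fin.≟ j) refl = refl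

setAt-other : (v : Partial n) (j : Fin n) (c : ℕ) {x : Fin n} → x ≢ j → setAt v j c x ≡ v x
setAt-other v j c {x} x≢j rewrite dec-false (x Fin.≟ j) x≢j = refl

unsetIn : (Fin n → Bool) → Partial n → Fin n → Bool
unsetIn S v j = S j ∧ is-nothing (v j)

-- Both phases of a queue have this shape: processing site i writes val i into the first
-- site along ord i that lies in S and is still unset.
FillsFirst : (S : Fin n → Bool) → (Fin n → List (Fin n)) → (Fin n → ℕ) → (Partial n → Fin n → Partial n) → Set
FillsFirst S ord val fill = ∀ v i →
  (first (unsetIn S v) (ord i) ≡ nothing × fill v i ≡ v) ⊎
  (∃ λ j → first (unsetIn S v) (ord i) ≡ just j × fill v i ≡ setAt v j (val i))

phaseI-fills : (q : Queue n) (u : Word n) → FillsFirst (not ∘ lookup q) leftOrder (suc ∘ u) (phaseIStep q u)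
phaseI-fills q u v i with first (λ j → not (lookup q j) ∧ is-nothing (v j)) (leftOrder i)
... | nothing = inj₁ (refl , refl)
... | just j  = inj₂ (j , refl , refl)

phaseII-fills : (q : Queue n) (u : Word n) → FillsFirst (lookup q) rightOrder u (phaseIIStep q u)
phaseII-fills q u v i with first (λ j → lookup q j ∧ is-nothing (v j)) (rightOrder i)
... | nothing = inj₁ (refl , refl)
... | just j  = inj₂ (j , refl , refl)

module Fill (S : Fin n → Bool) (ord : Fin n → List (Fin n)) (ord-complete : ∀ i x → x ∈ ord i)
            (val : Fin n → ℕ) (fill : Partial n → Fin n → Partial n) (view : FillsFirst S ord val fill) where

  free : Partial n → Fin n → Bool
  free = unsetIn S

  free⇒ : ∀ {v j} → free v j ≡ true → S j ≡ true × v j ≡ nothing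
  free⇒ {v} {j} h with S j | v j
  ... | true | nothing = refl , refl

  filled : Partial n → ℕ
  filled v = # (S ∩ is-just ∘ v)

  size : ℕ
  size = # S

  filled≡size⇒set : ∀ v → filled v ≡ size → ∀ x → S x ≡ true → ∃ λ c → v x ≡ just c
  filled≡size⇒set v full x Sx
    with v x in vx | ∑-tight (ind ∘ (S ∩ is-just ∘ v)) (ind ∘ S) (λ y → ind-mono (∧-conicalˡ _ _)) (≤-reflexive (sym full)) x
  ... | just c  | _  = c , refl
  ... | nothing | le = ⊥-elim (<⇒≱ (subst (λ t → ind (t ∧ false) < ind t) (sym Sx) (s≤s z≤n)) le)

  fill-nothing⇒full : ∀ v i → first (free v) (ord i) ≡ nothing → filled v ≡ size
  fill-nothing⇒full v i e = #-cong set
    where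
    set : ∀ x → (S ∩ is-just ∘ v) x ≡ S x
    set x with first-nothing (free v) (ord i) e (ord-complete i x)
    ... | not-free with S x | v x
    ...   | true  | just _ = refl
    ...   | false | _      = refl

  fill-just-filled : ∀ v i j → first (free v) (ord i) ≡ just j → filled (setAt v j (val i)) ≡ suc (filled v)
  fill-just-filled v i j e = ∑-insert _ _ j (λ x x≢j → cong (λ t → ind (S x ∧ is-just t)) (sym (setAt-other v j (val i) x≢j))) at-j
    where
    at-j : ind (S j ∧ is-just (setAt v j (val i) j)) ≡ suc (ind (S j ∧ is-just (v j)))
    at-j rewrite setAt-same v j (val i) with free⇒ {v} (proj₁ (first-just (free v) (ord i) e))
    ... | Sj , vj rewrite Sj | vj = refl

  fill-keep : ∀ v i x c → v x ≡ just c → fill v i x ≡ just c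
  fill-keep v i x c vx with view v i
  ... | inj₁ (_ , e) rewrite e = vx
  ... | inj₂ (j , e , e′) rewrite e′ with x Fin.≟ j
  ...   | no _     = vx
  ...   | yes refl with trans (sym vx) (proj₂ (free⇒ {v} (proj₁ (first-just (free v) (ord i) e))))
  ...     | ()

  fill-outside : ∀ v i x → S x ≡ false → fill v i x ≡ v x
  fill-outside v i x Sx with view v i
  ... | inj₁ (_ , e) rewrite e = refl
  ... | inj₂ (j , e , e′) rewrite e′ with x Fin.≟ j
  ...   | no _     = refl
  ...   | yes refl = ⊥-elim (true≢false (trans (sym (proj₁ (free⇒ {v} (proj₁ (first-just (free v) (ord i) e))))) Sx))

  fill-source : ∀ v i x c → fill v i x ≡ just c → v x ≡ just c ⊎ c ≡ val i
  fill-source v i x c h with view v i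
  ... | inj₁ (_ , e) rewrite e = inj₁ h
  ... | inj₂ (j , e , e′) rewrite e′ with x Fin.≟ j
  ...   | no _     = inj₁ h
  ...   | yes refl = inj₂ (sym (just-injective h))

  run : Partial n → List (Fin n) → Partial n
  run = foldl fill

  run-filled : ∀ v bs → filled v + length bs ≤ size → filled (run v bs) ≡ filled v + length bs
  run-filled v []       _    = sym (+-identityʳ _)
  run-filled v (b ∷ bs) room with view v b
  ... | inj₁ (e , _) =
    ⊥-elim (<⇒≱ (m<m+n size (s≤s z≤n)) (subst (λ f → f + suc (length bs) ≤ size) (fill-nothing⇒full v b e) room))
  ... | inj₂ (j , e , e′) = begin
    filled (run (fill v b) bs)          ≡⟨ run-filled (fill v b) bs (subst (_≤ size) (sym shift) room) ⟩
    filled (fill v b) + length bs       ≡⟨ shift ⟩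
    filled v + suc (length bs)          ∎
    where
    open ≡-Reasoning
    one-more : filled (fill v b) ≡ suc (filled v)
    one-more = trans (cong filled e′) (fill-just-filled v b j e)
    shift : filled (fill v b) + length bs ≡ filled v + suc (length bs)
    shift = trans (cong (_+ length bs) one-more) (sym (+-suc (filled v) (length bs)))

  run-keep : ∀ v bs x c → v x ≡ just c → run v bs x ≡ just c
  run-keep v []       x c vx = vx
  run-keep v (b ∷ bs) x c vx = run-keep (fill v b) bs x c (fill-keep v b x c vx)

  run-outside : ∀ v bs x → S x ≡ false → run v bs x ≡ v x
  run-outside v []       x Sx = refl
  run-outside v (b ∷ bs) x Sx = trans (run-outside (fill v b) bs x Sx) (fill-outside v b x Sx)

  run-source : ∀ v bs x c → run v bs x ≡ just c → v x ≡ just c ⊎ Any (λ b → c ≡ val b) bs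
  run-source v []       x c h = inj₁ h
  run-source v (b ∷ bs) x c h with run-source (fill v b) bs x c h
  ... | inj₂ from-bs = inj₂ (there from-bs)
  ... | inj₁ h′ with fill-source v b x c h′
  ...   | inj₁ vx  = inj₁ vx
  ...   | inj₂ c≡b = inj₂ (here c≡b)

-- Queues

p-typeOf : ∀ {n} (u : Word n) → IsWord u → ∀ α → p (typeOf u) α ≡ # (λ x → u x ≤ᵇ α)
p-typeOf u u-pos zero = sym (∑-zero _ (λ x → cong ind (dec-false (u x ≤? 0) (<⇒≱ (u-pos x)))))
p-typeOf u u-pos (suc α) = begin
  p (typeOf u) α + typeOf u (suc α)                       ≡⟨ cong₂ _+_ (p-typeOf u u-pos α) (count≡# (λ x → u x ≡ᵇ suc α)) ⟩
  # (λ x → u x ≤ᵇ α) + # (λ x → u x ≡ᵇ suc α)             ≡⟨ ∑-+ (λ x → ind (u x ≤ᵇ α)) (λ x → ind (u x ≡ᵇ suc α)) ⟨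
  ∑ (λ x → ind (u x ≤ᵇ α) + ind (u x ≡ᵇ suc α))          ≡⟨ ∑-cong (λ x → split (u x)) ⟩
  # (λ x → u x ≤ᵇ suc α)                                  ∎
  where
  open ≡-Reasoning
  split : ∀ a → ind (a ≤ᵇ α) + ind (a ≡ᵇ suc α) ≡ ind (a ≤ᵇ suc α)
  split a with a ≤? α
  ... | yes a≤α rewrite dec-true (a ≤? α) a≤α | dec-false (a ≟ suc α) (<⇒≢ (s≤s a≤α)) | dec-true (a ≤? suc α) (m≤n⇒m≤1+n a≤α) = refl
  ... | no a≰α rewrite dec-false (a ≤? α) a≰α with a ≟ suc α
  ...   | yes refl rewrite dec-true (suc α ≤? suc α) ≤-refl | dec-true (α ≟ α) refl = refl
  ...   | no a≢1+α rewrite dec-false (a ≟ suc α) a≢1+α | dec-false (a ≤? suc α) (λ a≤1+α → a≢1+α (≤-antisym a≤1+α (≰⇒> a≰α))) = refl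

lookup-lowest : ∀ {n} (w : Word n) α x → lookup (lowest w (# (λ i → w i ≤ᵇ α))) x ≡ (w x ≤ᵇ α)
lookup-lowest w α x rewrite lookup∘tabulate (λ j → count (λ i → w i ≤ᵇ w j) ≤ᵇ # (λ i → w i ≤ᵇ α)) x
                          | count≡# (λ i → w i ≤ᵇ w x) with w x ≤? α
... | yes wx≤α rewrite dec-true (w x ≤? α) wx≤α = dec-true (_ ≤? _) (#-mono λ i wi≤wx → dec-true (w i ≤? α) (≤-trans (does⇒ (w i ≤? w x) wi≤wx) wx≤α))
... | no wx≰α  rewrite dec-false (w x ≤? α) wx≰α = dec-false (_ ≤? _) (<⇒≱ (∑-strict _ _ x (λ i → ind-mono (below i)) at-x))
  where
  below : ∀ i → (w i ≤ᵇ α) ≡ true → (w i ≤ᵇ w x) ≡ true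
  below i wi≤α = dec-true (w i ≤? w x) (≤-trans (does⇒ (w i ≤? α) wi≤α) (<⇒≤ (≰⇒> wx≰α)))
  at-x : ind (w x ≤ᵇ α) < ind (w x ≤ᵇ w x)
  at-x rewrite dec-false (w x ≤? α) wx≰α | dec-true (w x ≤? w x) ≤-refl = s≤s z≤n

lcount : ∀ {A : Set} → (A → Bool) → List A → ℕ
lcount P xs = sum (List.map (ind ∘ P) xs)

lcount-↭ : ∀ {A : Set} (P : A → Bool) {xs ys} → xs ↭ ys → lcount P xs ≡ lcount P ys
lcount-↭ P xs↭ys = sum-↭ (↭-map⁺ (ind ∘ P) xs↭ys)

lcount-tabulate : ∀ {A : Set} (P : A → Bool) (f : Fin n → A) → lcount P (List.tabulate f) ≡ # (P ∘ f)
lcount-tabulate {zero}  P f = refl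
lcount-tabulate {suc n} P f = cong (ind (P (f zero)) +_) (lcount-tabulate P (f ∘ suc))

module _ {A : Set} (u : A → ℕ) (α : ℕ) where

  private
    Sorted : List A → Set
    Sorted = Linked (λ a b → u a ≤ u b)

    atMost : A → Bool
    atMost x = u x ≤ᵇ α

  sorted-above : ∀ y ys → α < u y → Sorted (y ∷ ys) → All (λ x → α < u x) (y ∷ ys)
  sorted-above y []       α<y _          = α<y ∷ []
  sorted-above y (z ∷ ys) α<y (y≤z ∷ ys↑) = α<y ∷ sorted-above z ys (<-≤-trans α<y y≤z) ys↑

  lcount-above : ∀ ys → All (λ x → α < u x) ys → lcount atMost ys ≡ 0
  lcount-above []       []             = refl
  lcount-above (y ∷ ys) (α<y ∷ above) rewrite dec-false (u y ≤? α) (<⇒≱ α<y) = lcount-above ys above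

  sorted-split : ∀ xs → Sorted xs →
    All (λ x → u x ≤ α) (take (lcount atMost xs) xs) × All (λ x → α < u x) (drop (lcount atMost xs) xs)
  sorted-split []       _   = [] , []
  sorted-split (x ∷ xs) xs↑ with u x ≤? α
  ... | yes x≤α rewrite dec-true (u x ≤? α) x≤α = map₁ (x≤α ∷_) (sorted-split xs (Linked.tail xs↑))
  ... | no x≰α  rewrite dec-false (u x ≤? α) x≰α
                      | lcount-above xs (All.tail (sorted-above x xs (≰⇒> x≰α) xs↑)) = [] , sorted-above x xs (≰⇒> x≰α) xs↑

module Greedy (q : Queue n) (u : Word n) (A : Subset n) {M : Matching}
              (final : FinalMatching (parens A q) M) (A≤q : ∣ A ∣ ≤ ∣ q ∣) where

  open SiteParens A q using (closePos; unmatched-close-site-surplus)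
  open Fill (lookup q) rightOrder ∈-rightOrder u (phaseIIStep q u) (phaseII-fills q u)

  set : Partial n → Fin n → Bool
  set v = lookup q ∩ is-just ∘ v

  Bounded : Partial n → (Fin n → Bool) → Set
  Bounded v P = ∀ y → free v y ≡ true → ∀ z → # (set v ∩ siteArc y z) ≤ # (P ∩ siteArc y z)

  Closed : Partial n → Set
  Closed v = ∀ x → set v x ≡ true → Matched M (closePos x)

  module Process (v : Partial n) (P : Fin n → Bool) (bounded : Bounded v P) (closed : Closed v)
              (P⊆A : P ⊆ lookup A) (b : Fin n) (b∈A : lookup A b ≡ true) (b∉P : P b ≡ false) where

    P′ : Fin n → Bool
    P′ = P ∪ ⁅ b ⁆

    P⊆P′ : P ⊆ P′
    P⊆P′ x Px = cong (_∨ ⁅ b ⁆ x) Px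

    P′⊆A : P′ ⊆ lookup A
    P′⊆A x h with P x in Px
    ... | true  = P⊆A x Px
    ... | false with x Fin.≟ b
    ...   | yes refl = b∈A

    module Lands (f : Fin n) (found : first (free v) (rightOrder b) ≡ just f) where

      v′ : Partial n
      v′ = setAt v f (u b)

      f-free : free v f ≡ true
      f-free = proj₁ (first-just (free v) (rightOrder b) found)

      -- No site of [b, f) is free, so an arc (y, z] through f that starts at a free y also contains b.
      arc-f⇒arc-b : ∀ {y z} → free v y ≡ true → siteArc y z f ≡ true → siteArc y z b ≡ true
      arc-f⇒arc-b {y} {z} y-free f∈ =
        dec-true (arcOC? (toℕ y) (toℕ z) (toℕ b)) (ArcOC-retreat skipped (does⇒ (arcOC? (toℕ y) (toℕ z) (toℕ f)) f∈))
        where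
        skipped : ¬ ArcCO (toℕ b) (toℕ f) (toℕ y)
        skipped y∈ = true≢false (trans (sym y-free) (first-rightOrder (free v) b f found y y∈))

      landing-bound : ∀ {y} → free v y ≡ true → ∀ z →
        # ((set v ∪ ⁅ f ⁆) ∩ siteArc y z) ≤ # (P′ ∩ siteArc y z)
      landing-bound {y} y-free z = begin
        # ((set v ∪ ⁅ f ⁆) ∩ J)   ≤⟨ #-∪⁅⁆-≤ (set v) J f ⟩
        # (set v ∩ J) + ind (J f) ≤⟨ +-mono-≤ (bounded y y-free z) (ind-mono (arc-f⇒arc-b {y} {z} y-free)) ⟩
        # (P ∩ J) + ind (J b)     ≡⟨ #-∪⁅⁆ P J b b∉P ⟨
        # (P′ ∩ J)                ∎
        where
        open ≤-Reasoning
        J = siteArc y z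

      set-v′ : set v′ ⊆ (set v ∪ ⁅ f ⁆)
      set-v′ x h with x Fin.≟ f
      ... | yes refl = ∨-zeroʳ (set v x)
      ... | no x≢f = trans (∨-identityʳ (set v x)) h

      free-v′⇒free-v : ∀ {y} → free v′ y ≡ true → free v y ≡ true
      free-v′⇒free-v {y} h with y Fin.≟ f
      ... | no _ = h
      free-v′⇒free-v {y} h | yes refl = ⊥-elim (true≢false (trans (sym h) (∧-zeroʳ _)))

      bounded′ : Bounded v′ P′
      bounded′ y y-free z = ≤-trans (#-mono (∩-monoˡ (siteArc y z) set-v′)) (landing-bound (free-v′⇒free-v y-free) z)

      -- Otherwise the arc (y, f] after the nearest free site y before f would break the surplus
      -- of closing parentheses that an unmatched ")" of f forces.
      f-matched : Matched M (closePos f)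
      f-matched with Parens.matched? (parens A q) M (closePos f)
      ... | yes m = m
      ... | no f-unmatched with argmax-∃ (free v) (cyclicRank n (toℕ f) ∘ toℕ) f-free
      ...   | y , y-free , nearest = ⊥-elim (<⇒≱ surplus (begin
        # (lookup q ∩ J)          ≤⟨ #-mono q∩J⊆ ⟩
        # ((set v ∪ ⁅ f ⁆) ∩ J)   ≤⟨ landing-bound y-free f ⟩
        # (P′ ∩ J)                ≤⟨ #-mono (∩-monoˡ J P′⊆A) ⟩
        # (lookup A ∩ J)          ∎))
        where
        open ≤-Reasoning
        J = siteArc y f
        f∈q = proj₁ (free⇒ {v} f-free)
        surplus : suc (# (lookup A ∩ J)) ≤ # (lookup q ∩ J)
        surplus = unmatched-close-site-surplus final A≤q (proj₁ (free⇒ {v} y-free)) f∈q f-unmatched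
        filled-or-f : ∀ x → lookup q x ≡ true → J x ≡ true → (set v ∪ ⁅ f ⁆) x ≡ true
        filled-or-f x x∈q x∈J with x Fin.≟ f
        ... | yes refl = ∨-zeroʳ _
        ... | no x≢f with v x in vx
        ...   | just _  rewrite x∈q = refl
        ...   | nothing = ⊥-elim (<⇒≱ closer (nearest x x-free))
          where
          x-free : free v x ≡ true
          x-free rewrite vx | x∈q = refl
          closer : cyclicRank n (toℕ f) (toℕ y) < cyclicRank n (toℕ f) (toℕ x)
          closer = cyclicRank-ArcOC (Fin.toℕ<n y) (does⇒ (arcOC? (toℕ y) (toℕ f) (toℕ x)) x∈J) (x≢f ∘ Fin.toℕ-injective)
        q∩J⊆ : (lookup q ∩ J) ⊆ ((set v ∪ ⁅ f ⁆) ∩ J)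
        q∩J⊆ x h = ∩-intro {P = set v ∪ ⁅ f ⁆} {J} (filled-or-f x x∈q x∈J) x∈J
          where
          x∈q = ∧-conicalˡ (lookup q x) _ h
          x∈J = ∧-conicalʳ (lookup q x) _ h

      closed′ : Closed v′
      closed′ x h with x Fin.≟ f
      ... | yes refl = f-matched
      ... | no x≢f   = closed x h

    processed : Bounded (phaseIIStep q u v b) P′ × Closed (phaseIIStep q u v b)
    processed with phaseII-fills q u v b
    ... | inj₁ (_ , unchanged) rewrite unchanged =
      (λ y y-free z → ≤-trans (bounded y y-free z) (#-mono (∩-monoˡ (siteArc y z) P⊆P′))) , closed
    ... | inj₂ (f , found , lands) rewrite lands = Lands.bounded′ f found , Lands.closed′ f found

  run-closed : ∀ bs v (P : Fin n → Bool) → Bounded v P → Closed v → P ⊆ lookup A →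
    All (λ b → lookup A b ≡ true) bs → Unique bs → All (λ b → P b ≡ false) bs → Closed (run v bs)
  run-closed []       v P bounded closed P⊆A _ _ _ = closed
  run-closed (b ∷ bs) v P bounded closed P⊆A (b∈A ∷ bs⊆A) (b∉bs ∷ unique) (b∉P ∷ bs∉P) =
    run-closed bs (phaseIIStep q u v b) P′ (proj₁ processed) (proj₂ processed) P′⊆A
               bs⊆A unique (All.zipWith still-new (bs∉P , b∉bs))
    where
    open Process v P bounded closed P⊆A b b∈A b∉P
    still-new : ∀ {x} → P x ≡ false × b ≢ x → P′ x ≡ false
    still-new {x} (x∉P , b≢x) rewrite x∉P = dec-false (x Fin.≟ b) (b≢x ∘ sym)

module Queueing (u : Word n) (α k : ℕ) (k≡ : k ≡ # (λ x → u x ≤ᵇ α))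
                (q : Queue n) (k≤q : k ≤ ∣ q ∣) (σ : List (Fin n)) (sorting : SortingPerm u σ) where

  A : Subset n
  A = lowest u k

  A-letters : ∀ x → lookup A x ≡ (u x ≤ᵇ α)
  A-letters x rewrite k≡ = lookup-lowest u α x

  ∣A∣≡k : ∣ A ∣ ≡ k
  ∣A∣≡k = trans (∣∣≡# A) (trans (#-cong A-letters) (sym k≡))

  length-σ : length σ ≡ n
  length-σ = trans (↭-length (proj₁ sorting)) (length-tabulate id)

  unique-σ : Unique σ
  unique-σ = Unique-resp-↭ (↭⇒↭ₛ (↭-sym (proj₁ sorting))) (allFin⁺ _)
    where open import Data.List.Relation.Binary.Permutation.Setoid.Properties (setoid (Fin n)) using (Unique-resp-↭)

  d : ℕ
  d = ∣ q ∣ ∸ k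

  k+d≡q : k + d ≡ ∣ q ∣
  k+d≡q = m+[n∸m]≡n k≤q

  σ-split : All (λ x → u x ≤ α) (take k σ) × All (λ x → α < u x) (drop k σ)
  σ-split = subst (λ t → All (λ x → u x ≤ α) (take t σ) × All (λ x → α < u x) (drop t σ))
                  (trans (lcount-↭ (λ x → u x ≤ᵇ α) (proj₁ sorting)) (trans (lcount-tabulate (λ x → u x ≤ᵇ α) id) (sym k≡)))
                  (sorted-split u α σ (proj₂ sorting))

  high-q : All (λ x → α < u x) (drop ∣ q ∣ σ)
  high-q = subst (λ t → All _ (drop t σ)) k+d≡q (subst (All _) (drop-drop k d σ) (AllP.drop⁺ d (proj₂ σ-split)))

  module PhaseI = Fill (not ∘ lookup q) leftOrder ∈-leftOrder (suc ∘ u) (phaseIStep q u) (phaseI-fills q u)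
  module PhaseII = Fill (lookup q) rightOrder ∈-rightOrder u (phaseIIStep q u) (phaseII-fills q u)

  unset : Partial n
  unset _ = nothing

  afterI afterA afterII : Partial n
  afterI = PhaseI.run unset (reverse (drop ∣ q ∣ σ))
  afterA = PhaseII.run afterI (take k σ)
  afterII = PhaseII.run afterA (take d (drop k σ))

  output : ∀ x → applyQueue q u σ x ≡ fromMaybe 0 (afterII x)
  output x = cong (λ v → fromMaybe 0 (v x)) (begin
    PhaseII.run afterI (take ∣ q ∣ σ)                          ≡⟨ cong (λ t → PhaseII.run afterI (take t σ)) k+d≡q ⟨
    PhaseII.run afterI (take (k + d) σ)                        ≡⟨ cong (PhaseII.run afterI) (take-+ k d σ) ⟩
    PhaseII.run afterI (take k σ ++ take d (drop k σ))         ≡⟨ foldl-++ (phaseIIStep q u) afterI (take k σ) _ ⟩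
    afterII                                                     ∎)
    where open ≡-Reasoning

  afterI-q : ∀ x → lookup q x ≡ true → afterI x ≡ nothing
  afterI-q x x∈q = PhaseI.run-outside unset (reverse (drop ∣ q ∣ σ)) x (cong not x∈q)

  afterI-full : PhaseI.filled afterI ≡ PhaseI.size
  afterI-full = trans (PhaseI.run-filled unset (reverse (drop ∣ q ∣ σ)) (≤-reflexive fits)) fits
    where
    nothing-filled : PhaseI.filled unset ≡ 0
    nothing-filled = ∑-zero _ (λ x → cong ind (∧-zeroʳ (not (lookup q x))))
    fits : PhaseI.filled unset + length (reverse (drop ∣ q ∣ σ)) ≡ PhaseI.size
    fits = begin
      PhaseI.filled unset + length (reverse (drop ∣ q ∣ σ)) ≡⟨ cong₂ _+_ nothing-filled (length-reverse (drop ∣ q ∣ σ)) ⟩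
      length (drop ∣ q ∣ σ)                                 ≡⟨ trans (length-drop ∣ q ∣ σ) (cong (_∸ ∣ q ∣) length-σ) ⟩
      n ∸ ∣ q ∣                                             ≡⟨ cong (_∸ ∣ q ∣) (#-complement (lookup q)) ⟨
      (# (lookup q) + PhaseI.size) ∸ ∣ q ∣                  ≡⟨ cong (λ t → (t + PhaseI.size) ∸ ∣ q ∣) (∣∣≡# q) ⟨
      (∣ q ∣ + PhaseI.size) ∸ ∣ q ∣                         ≡⟨ m+n∸m≡n ∣ q ∣ _ ⟩
      PhaseI.size                                           ∎
      where open ≡-Reasoning

  afterI-outside-q : ∀ x → lookup q x ≡ false → ∃ λ c → afterI x ≡ just c × α < c
  afterI-outside-q x x∉q with PhaseI.filled≡size⇒set afterI afterI-full x (cong not x∉q)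
  ... | c , afterIx with PhaseI.run-source unset (reverse (drop ∣ q ∣ σ)) x c afterIx
  ...   | inj₂ from = c , afterIx , above (AnyP.reverse⁻ from)
    where
    above : Any (λ b → c ≡ suc (u b)) (drop ∣ q ∣ σ) → α < c
    above from with All.lookupAny high-q from
    ... | α<u , c≡ = subst (α <_) (sym c≡) (m<n⇒m<1+n α<u)

  afterI-unset-in-q : ∀ x → (lookup q ∩ is-just ∘ afterI) x ≡ false
  afterI-unset-in-q x with lookup q x in x∈q
  ... | false = refl
  ... | true rewrite afterI-q x x∈q = refl

  afterI-nothing-in-q : PhaseII.filled afterI ≡ 0
  afterI-nothing-in-q = ∑-zero _ (cong ind ∘ afterI-unset-in-q)

  q-size : PhaseII.size ≡ ∣ q ∣
  q-size = sym (∣∣≡# q)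

  afterA-filled : PhaseII.filled afterA ≡ k
  afterA-filled = trans (PhaseII.run-filled afterI (take k σ) (subst₂ _≤_ (sym fits) (sym q-size) k≤q)) fits
    where
    fits : PhaseII.filled afterI + length (take k σ) ≡ k
    fits = cong₂ _+_ afterI-nothing-in-q (length-take-≤ k σ (subst (k ≤_) (sym length-σ) (≤-trans k≤q (∣p∣≤n q))))

  afterII-full : PhaseII.filled afterII ≡ PhaseII.size
  afterII-full = trans (PhaseII.run-filled afterA (take d (drop k σ)) (≤-reflexive fits)) fits
    where
    rest-length : length (take d (drop k σ)) ≡ d
    rest-length = length-take-≤ d (drop k σ)
      (subst (d ≤_) (sym (trans (length-drop k σ) (cong (_∸ k) length-σ))) (∸-monoˡ-≤ k (∣p∣≤n q)))
    fits : PhaseII.filled afterA + length (take d (drop k σ)) ≡ PhaseII.size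
    fits = trans (cong₂ _+_ afterA-filled rest-length) (trans k+d≡q (sym q-size))

  w : Word n
  w = applyQueue q u σ

  filledByA : Fin n → Bool
  filledByA = lookup q ∩ is-just ∘ afterA

  filledByA⇒low : ∀ x → filledByA x ≡ true → w x ≤ α
  filledByA⇒low x h with afterA x in afterAx
  ... | nothing = ⊥-elim (true≢false (trans (sym h) (∧-zeroʳ _)))
  ... | just c rewrite output x | PhaseII.run-keep afterA (take d (drop k σ)) x c afterAx
    with PhaseII.run-source afterI (take k σ) x c afterAx
  ...   | inj₁ afterIx  = ⊥-elim (just≢nothing (trans (sym afterIx) (afterI-q x (∧-conicalˡ (lookup q x) _ h))))
  ...   | inj₂ from with All.lookupAny (proj₁ σ-split) from
  ...     | u≤α , c≡ = subst (_≤ α) (sym c≡) u≤α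

  outside-q⇒high : ∀ x → lookup q x ≡ false → α < w x
  outside-q⇒high x x∉q
    rewrite output x | PhaseII.run-outside afterA (take d (drop k σ)) x x∉q | PhaseII.run-outside afterI (take k σ) x x∉q
    with afterI-outside-q x x∉q
  ... | c , afterIx , α<c rewrite afterIx = α<c

  filledLate⇒high : ∀ x → lookup q x ≡ true → afterA x ≡ nothing → α < w x
  filledLate⇒high x x∈q afterAx rewrite output x with PhaseII.filled≡size⇒set afterII afterII-full x x∈q
  ... | c , afterIIx rewrite afterIIx with PhaseII.run-source afterA (take d (drop k σ)) x c afterIIx
  ...   | inj₁ afterAx′ = ⊥-elim (just≢nothing (trans (sym afterAx′) afterAx))
  ...   | inj₂ from with All.lookupAny (AllP.take⁺ d (proj₂ σ-split)) from
  ...     | α<u , c≡ = subst (α <_) (sym c≡) α<u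

  ¬filledByA⇒high : ∀ x → filledByA x ≡ false → α < w x
  ¬filledByA⇒high x h with lookup q x in x∈q | afterA x in afterAx
  ... | false | _       = outside-q⇒high x x∈q
  ... | true  | nothing = filledLate⇒high x x∈q afterAx

  -- The k sites filled by A carry letters ≤ α and every other site a larger one, which
  -- therefore has at least k + 1 letters weakly below it.
  lowest⇒filledByA : ∀ j → lookup (lowest w k) j ≡ true → filledByA j ≡ true
  lowest⇒filledByA j j-low with filledByA j in j-late
  ... | true  = refl
  ... | false = ⊥-elim (<⇒≱ too-many at-most-k)
    where
    at-most-k : count (λ i → w i ≤ᵇ w j) ≤ k
    at-most-k = does⇒ (count (λ i → w i ≤ᵇ w j) ≤? k) (trans (sym (lookup∘tabulate _ j)) j-low)
    below-j : (filledByA ∪ ⁅ j ⁆) ⊆ (λ i → w i ≤ᵇ w j)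
    below-j i h with i Fin.≟ j
    ... | yes refl = dec-true (w i ≤? w i) ≤-refl
    ... | no _     = dec-true (w i ≤? w j)
                       (≤-trans (filledByA⇒low i (trans (sym (∨-identityʳ _)) h)) (<⇒≤ (¬filledByA⇒high j j-late)))
    too-many : suc k ≤ count (λ i → w i ≤ᵇ w j)
    too-many = begin
      suc k                         ≡⟨ cong suc afterA-filled ⟨
      suc (# filledByA)           ≡⟨ #-∪⁅⁆-new filledByA j j-late ⟨
      # (filledByA ∪ ⁅ j ⁆)       ≤⟨ #-mono below-j ⟩
      # (λ i → w i ≤ᵇ w j)          ≡⟨ count≡# (λ i → w i ≤ᵇ w j) ⟨
      count (λ i → w i ≤ᵇ w j)      ∎
      where open ≤-Reasoning

  lowest⇒matched : ∀ {M} → FinalMatching (parens A q) M → ∀ j → lookup (lowest w k) j ≡ true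
    → Matched M (SiteParens.closePos A q j)
  lowest⇒matched final j j-low =
    Greedy.run-closed q u A final A≤q (take k σ) afterI (λ _ → false) nothing-bounded nothing-closed (λ _ ())
      low-in-A (APP.take⁺ k unique-σ) (All.universal (λ _ → refl) _) j (lowest⇒filledByA j j-low)
    where
    A≤q : ∣ A ∣ ≤ ∣ q ∣
    A≤q = subst (_≤ ∣ q ∣) (sym ∣A∣≡k) k≤q
    low-in-A : All (λ x → lookup A x ≡ true) (take k σ)
    low-in-A = All.map (λ {x} u≤α → trans (A-letters x) (dec-true (u x ≤? α) u≤α)) (proj₁ σ-split)
    nothing-bounded : Greedy.Bounded q u A final A≤q afterI (λ _ → false)
    nothing-bounded y _ z = ≤-trans (≤-reflexive (∑-zero _ (λ x → cong (λ t → ind (t ∧ siteArc y z x)) (afterI-unset-in-q x)))) z≤n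
    nothing-closed : Greedy.Closed q u A final A≤q afterI
    nothing-closed x h = ⊥-elim (true≢false (trans (sym h) (afterI-unset-in-q x)))

lemma6p10 : ∀ {n} (u : Word n) → IsWord u → (k α : ℕ) → k ≡ p (typeOf u) α
  → (q : Queue n) → k ≤ ∣ q ∣
  → (σ : List (Fin n)) → SortingPerm u σ
  → (M : Matching) → FinalMatching (parens (lowest u k) q) M
  → (j : Fin n) → lookup (lowest (applyQueue q u σ) k) j ≡ true
  → ∃ λ b → (parens (lowest u k) q !? b ≡ just (j , false)) × Matched M b
lemma6p10 u u-pos k α k≡p q k≤q σ sorting M final j j-low =
  closePos j , parens-closePos (∧-conicalˡ _ _ (lowest⇒filledByA j j-low)) , lowest⇒matched final j j-low
  where
  open Queueing u α k (trans k≡p (p-typeOf u u-pos α)) q k≤q σ sorting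
  open SiteParens A q using (closePos; parens-closePos)
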